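{- Let $n\geq 2$ be an integer, $A_0,A_1,\dots,A_n\in\widehat{\mathbb{F}_q^{*}}$ and $x\in\mathbb{F}_q$. Then $$ {}_{n+1}F_n\!\left(\begin{array}{cccc} A_0, & A_1, & \dots, & A_n\\ & A_0\bar{A_1}, & \dots, & A_0\bar{A_n}\end{array}\Big|\;x\right)_q^{\star} =\frac{g(\bar{A_0}A_{n-1}A_n)}{g(A_{n-1})g(A_n)g(\bar{A_0}A_{n-1})g(\bar{A_0}A_n)}\cdot\frac{1}{q-1}\sum_{\psi\in\widehat{\mathbb{F}_q^{*}}}g(A_{n-1}\psi)g(A_n\psi)g(\bar{\psi})g(\bar{A_0}\bar{\psi})\;{}_{n}F_{n-1}\!\left(\begin{array}{ccccc} A_0, & A_1, & \dots, & A_{n-2}, & \bar{\psi}\\ & A_0\bar{A_1}, & \dots, & A_0\bar{A_{n-2}}, & A_0\psi\end{array}\Big|\;-x\right)_q^{\star} $$ $$ +\frac{q(q-1)\,(A_nA_{n-1})(-1)\,\delta(\bar{A_0}A_{n-1}A_n)}{g(A_{n-1})g(A_n)g(\bar{A_0}A_{n-1})g(\bar{A_0}A_n)}\;{}_{n-1}F_{n-2}\!\left(\begin{array}{cccc} A_0, & A_1, & \dots, & A_{n-2}\\ & A_0\bar{A_1}, & \dots, & A_0\bar{A_{n-2}}\end{array}\Big|\;x\right)_q^{\star}. $$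
   Context: Let $q$ be a prime power and $\mathbb{F}_q$ the finite field with $q$ elements. $\widehat{\mathbb{F}_q^{*}}$ denotes the group of multiplicative characters of $\mathbb{F}_q^{*}$; every character $\chi$ (including the trivial character $\varepsilon$) is extended to $\mathbb{F}_q$ by $\chi(0):=0$. $\bar{\chi}$ denotes the inverse character, and juxtaposition denotes pointwise product of characters. Fix a non-trivial additive character $\theta$ of $\mathbb{F}_q$ and define the Gauss sum $g(\chi):=\sum_{x\in\mathbb{F}_q}\chi(x)\theta(x)$. For $A_0,\dots,A_m,B_1,\dots,B_m\in\widehat{\mathbb{F}_q^{*}}$ ($m\geq 0$) and $x\in\mathbb{F}_q$ define $$ {}_{m+1}F_m\!\left(\begin{array}{cccc} A_0, & A_1, & \dots, & A_m\\ & B_1, & \dots, & B_m\end{array}\Big|\;x\right)_q^{\star}:=\frac{1}{q-1}\sum_{\chi\in\widehat{\mathbb{F}_q^{*}}}\prod_{i=0}^{m}\frac{g(A_i\chi)}{g(A_i)}\prod_{j=1}^{m}\frac{g(\overline{B_j\chi})}{g(\overline{B_j})}\,g(\bar{\chi})\,\chi(-1)^{m+1}\chi(x). $$ For $\chi\in\widehat{\mathbb{F}_q^{*}}$, $\delta(\chi)=1$ if $\chi=\varepsilon$ and $\delta(\chi)=0$ otherwise. -}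

module Defs where

open import Level using (0ℓ)
open import Data.Nat as ℕ using (ℕ; zero; suc)
open import Data.Bool using (Bool; true; false; if_then_else_)
open import Data.Product using (Σ; ∃; _×_; _,_)
open import Data.List as List using (List; []; _∷_; length)
open import Data.List.Membership.Propositional using (_∈_)
open import Data.List.Relation.Unary.Unique.Propositional using (Unique)
open import Data.List.Relation.Unary.AllPairs using (AllPairs)
open import Data.Vec as Vec using (Vec)
open import Relation.Nullary using (¬_; Dec; yes; no)
open import Relation.Nullary.Decidable using (⌊_⌋)
open import Relation.Binary.PropositionalEquality using (_≡_; _≢_)
open import Algebra.Structures using (IsCommutativeRing)

record Field : Set₁ where
  infixl 7 _*_ _/_
  infixl 6 _+_
  field
    Carrier : Set
    _+_ _*_ : Carrier → Carrier → Carrier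
    -_      : Carrier → Carrier
    0# 1#   : Carrier
    _⁻¹     : Carrier → Carrier
    isCommutativeRing : IsCommutativeRing _≡_ _+_ _*_ -_ 0# 1#
    0≢1     : 0# ≢ 1#
    inverseʳ : ∀ x → x ≢ 0# → x * (x ⁻¹) ≡ 1#
    0⁻¹≡0   : 0# ⁻¹ ≡ 0#
    _≟_     : (x y : Carrier) → Dec (x ≡ y)

  fromℕ : ℕ → Carrier
  fromℕ zero    = 0#
  fromℕ (suc n) = 1# + fromℕ n

  _^_ : Carrier → ℕ → Carrier
  x ^ zero  = 1#
  x ^ suc n = x * (x ^ n)

  _/_ : Carrier → Carrier → Carrier
  x / y = x * (y ⁻¹)

record FiniteField : Set₁ where
  field
    field′   : Field
    elems    : List (Field.Carrier field′)
    unique   : Unique elems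
    complete : ∀ x → x ∈ elems
  open Field field′ public
  q : ℕ
  q = length elems

-- A field of characteristic zero (codomain of the characters; plays the
-- role of ℂ).
record CharZeroField : Set₁ where
  field
    field′   : Field
  open Field field′ public
  field
    charZero : ∀ n → fromℕ (suc n) ≢ 0#

module _ (F : FiniteField) (K : CharZeroField) where
  private
    module F = FiniteField F
    module K = CharZeroField K

  Fun : Set
  Fun = F.Carrier → K.Carrier

  -- χ is a multiplicative character of F_q^* extended by χ(0) = 0
  record IsMultChar (χ : Fun) : Set where
    field
      at0  : χ F.0# ≡ K.0#
      at1  : χ F.1# ≡ K.1#
      mult : ∀ x y → χ (F._*_ x y) ≡ K._*_ (χ x) (χ y)

  record IsNontrivAddChar (θ : Fun) : Set where
    field
      add      : ∀ x y → θ (F._+_ x y) ≡ K._*_ (θ x) (θ y)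
      nontriv  : ∃ λ x → θ x ≢ K.1#

  record IsCharGroup (chars : List Fun) : Set where
    field
      members  : ∀ {χ} → χ ∈ chars → IsMultChar χ
      complete : ∀ χ → IsMultChar χ → ∃ λ ψ → ψ ∈ chars × (∀ x → χ x ≡ ψ x)
      distinct : AllPairs (λ χ ψ → ¬ (∀ x → χ x ≡ ψ x)) chars
      size     : length chars ≡ ℕ._∸_ F.q 1

  _·_ : Fun → Fun → Fun
  (χ · ψ) x = K._*_ (χ x) (ψ x)

  inv : Fun → Fun
  inv χ x = K._⁻¹ (χ x)

  ε : Fun
  ε x = if ⌊ x F.≟ F.0# ⌋ then K.0# else K.1#

  δ : Fun → K.Carrier
  δ χ = if allB F.elems then K.1# else K.0#
    where
      allB : List F.Carrier → Bool
      allB []       = true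
      allB (x ∷ xs) = if ⌊ χ x K.≟ ε x ⌋ then allB xs else false

  sumL : ∀ {A : Set} → List A → (A → K.Carrier) → K.Carrier
  sumL xs f = List.foldr (λ a s → K._+_ (f a) s) K.0# xs

  prodV : ∀ {n} → Vec Fun n → (Fun → K.Carrier) → K.Carrier
  prodV xs f = Vec.foldr _ (λ a s → K._*_ (f a) s) K.1# xs

  module WithData (θ : Fun) (chars : List Fun) where

    g : Fun → K.Carrier
    g χ = sumL F.elems (λ x → K._*_ (χ x) (θ x))

    -- _{m+1}F_m (A₀, As ; Bs | x)^⋆ ,  As = A₁..A_m, Bs = B₁..B_m
    hypF : (m : ℕ) → Fun → Vec Fun m → Vec Fun m → F.Carrier → K.Carrier
    hypF m A₀ As Bs x =
      K._*_ (K._⁻¹ (K.fromℕ (ℕ._∸_ F.q 1)))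
        (sumL chars (λ χ →
          K._*_ (K._/_ (g (A₀ · χ)) (g A₀))
          (K._*_ (prodV As (λ A → K._/_ (g (A · χ)) (g A)))
          (K._*_ (prodV Bs (λ B → K._/_ (g (inv (B · χ))) (g (inv B))))
          (K._*_ (g (inv χ))
          (K._*_ (K._^_ (χ (F.-_ F.1#)) (suc m))
                 (χ x)))))))

module Submission where

-- With A = Aₙ₋₁ and B = Aₙ, the χ-summand of the left side is the χ-summand of ₙ₋₁Fₙ₋₂ times Q(χ)/D,
-- where Q(χ) = g(Aχ) g(Bχ) g(Ā₀Aχ̄) g(Ā₀Bχ̄).  A product of two Gauss sums is a Jacobi sum times a
-- Gauss sum plus a δ-correction.  Expanding g(Aψ) g(ψ̄χ) and g(Bψ) g(Ā₀ψ̄χ̄) in this way and summing over ψ,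
-- orthogonality of characters collapses the product of the two Jacobi sums to (q-1) J(Ā₀Aχ̄, Bχ), which
-- also appears in g(Ā₀Aχ̄) g(Bχ) = J(Ā₀Aχ̄, Bχ) g(Ā₀AB) + ….  Comparing the two expansions gives
-- Q(χ) = g(Ā₀AB) (q-1)⁻¹ Σ_ψ g(Aψ) g(Bψ) g(ψ̄χ) g(Ā₀ψ̄χ̄) + q (q-1) (AB)(-1) δ(Ā₀AB),
-- and summing over χ, after exchanging the sums over χ and ψ, yields the two terms of the theorem.

open import Defs
open import Data.Nat using (ℕ; suc; _∸_)
open import Data.List using (List)
open import Data.Vec using (Vec; _∷ʳ_; map)
open import Data.Vec.Relation.Unary.All using (All)
open import Relation.Binary.PropositionalEquality using (_≡_)

open import Level using (0ℓ)
open import Data.Nat as ℕ using (zero)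
open import Data.Bool using (Bool; true; false; if_then_else_)
open import Data.Sum using (_⊎_; inj₁; inj₂)
open import Data.Product using (Σ; ∃; _×_; _,_; proj₁; proj₂)
open import Data.Empty using (⊥; ⊥-elim)
open import Data.List using ([]; _∷_; length)
open import Data.List.Membership.Propositional using (_∈_; find)
open import Data.List.Relation.Unary.Any using (here; there; satisfied)
open import Data.List.Relation.Unary.All as ListAll using ([]; _∷_) renaming (All to ListAll)
open import Data.List.Relation.Unary.All.Properties.Core using (¬All⇒Any¬)
open import Data.List.Relation.Unary.AllPairs using (AllPairs; []; _∷_)
open import Data.Vec using ([]; _∷_)
open import Relation.Nullary using (¬_; Dec; yes; no)
open import Relation.Binary.PropositionalEquality using (_≢_; refl; sym; trans; cong; cong₂; module ≡-Reasoning)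
open import Algebra.Bundles using (CommutativeRing)
open import Algebra.Structures using (IsCommutativeRing)

module FieldProperties (𝔽 : Field) where
  open Field 𝔽 public
  open IsCommutativeRing isCommutativeRing public
    using (+-assoc; +-comm; +-identityˡ; +-identityʳ; -‿inverseˡ; -‿inverseʳ;
           *-assoc; *-comm; *-identityˡ; *-identityʳ; distribˡ; distribʳ; zeroˡ; zeroʳ)

  commutativeRing : CommutativeRing 0ℓ 0ℓ
  commutativeRing = record { isCommutativeRing = isCommutativeRing }

  open import Algebra.Properties.Ring (CommutativeRing.ring commutativeRing) public
    using (-‿distribˡ-*; -‿distribʳ-*; -‿involutive; -1*x≈-x)
  open import Algebra.Properties.AbelianGroup (CommutativeRing.+-abelianGroup commutativeRing) public
    using () renaming (∙-cancelˡ to +-cancelˡ; identityʳ-unique to x+y≡x⇒y≡0;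
                       ⁻¹-∙-comm to -‿+-comm; inverseʳ-unique to -‿inverseʳ-unique; x∙y⁻¹≈ε⇒x≈y to x-y≡0⇒x≡y)
  open import Algebra.Solver.Ring.NaturalCoefficients.Default (CommutativeRing.commutativeSemiring commutativeRing) public
    using (solve; _:=_; _:+_; _:*_; con)
  open ≡-Reasoning

  1≢0 : 1# ≢ 0#
  1≢0 e = 0≢1 (sym e)

  inverseˡ : ∀ x → x ≢ 0# → x ⁻¹ * x ≡ 1#
  inverseˡ x x≢0 = trans (*-comm _ _) (inverseʳ x x≢0)

  *-cancelˡ : ∀ x {y z} → x ≢ 0# → x * y ≡ x * z → y ≡ z
  *-cancelˡ x {y} {z} x≢0 e = begin
    y              ≡⟨ sym (*-identityˡ y) ⟩
    1# * y         ≡⟨ cong (_* y) (sym (inverseˡ x x≢0)) ⟩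
    x ⁻¹ * x * y   ≡⟨ *-assoc _ _ _ ⟩
    x ⁻¹ * (x * y) ≡⟨ cong (x ⁻¹ *_) e ⟩
    x ⁻¹ * (x * z) ≡⟨ sym (*-assoc _ _ _) ⟩
    x ⁻¹ * x * z   ≡⟨ cong (_* z) (inverseˡ x x≢0) ⟩
    1# * z         ≡⟨ *-identityˡ z ⟩
    z              ∎

  x*y≡0⇒x≡0⊎y≡0 : ∀ {x y} → x * y ≡ 0# → x ≡ 0# ⊎ y ≡ 0#
  x*y≡0⇒x≡0⊎y≡0 {x} {y} e with x ≟ 0#
  ... | yes x≡0 = inj₁ x≡0
  ... | no x≢0  = inj₂ (*-cancelˡ x x≢0 (trans e (sym (zeroʳ x))))

  x*y≢0 : ∀ {x y} → x ≢ 0# → y ≢ 0# → x * y ≢ 0#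
  x*y≢0 x≢0 y≢0 e with x*y≡0⇒x≡0⊎y≡0 e
  ... | inj₁ x≡0 = x≢0 x≡0
  ... | inj₂ y≡0 = y≢0 y≡0

  ⁻¹-unique : ∀ x y → x * y ≡ 1# → y ≡ x ⁻¹
  ⁻¹-unique x y e with x ≟ 0#
  ... | yes x≡0 = ⊥-elim (1≢0 (trans (sym e) (trans (cong (_* y) x≡0) (zeroˡ y))))
  ... | no x≢0  = *-cancelˡ x x≢0 (trans e (sym (inverseʳ x x≢0)))

  1⁻¹≡1 : 1# ⁻¹ ≡ 1#
  1⁻¹≡1 = sym (⁻¹-unique 1# 1# (*-identityˡ 1#))

  ⁻¹-involutive : ∀ x → x ⁻¹ ⁻¹ ≡ x
  ⁻¹-involutive x with x ≟ 0#
  ... | yes refl = trans (cong _⁻¹ 0⁻¹≡0) 0⁻¹≡0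
  ... | no x≢0   = sym (⁻¹-unique (x ⁻¹) x (inverseˡ x x≢0))

  ⁻¹-distrib-* : ∀ x y → (x * y) ⁻¹ ≡ x ⁻¹ * y ⁻¹
  ⁻¹-distrib-* x y with x ≟ 0# | y ≟ 0#
  ... | yes refl | _ = begin
    (0# * y) ⁻¹   ≡⟨ cong _⁻¹ (zeroˡ y) ⟩
    0# ⁻¹         ≡⟨ 0⁻¹≡0 ⟩
    0#            ≡⟨ sym (zeroˡ _) ⟩
    0# * y ⁻¹     ≡⟨ cong (_* y ⁻¹) (sym 0⁻¹≡0) ⟩
    0# ⁻¹ * y ⁻¹  ∎
  ... | no _ | yes refl = begin
    (x * 0#) ⁻¹   ≡⟨ cong _⁻¹ (zeroʳ x) ⟩
    0# ⁻¹         ≡⟨ 0⁻¹≡0 ⟩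
    0#            ≡⟨ sym (zeroʳ _) ⟩
    x ⁻¹ * 0#     ≡⟨ cong (x ⁻¹ *_) (sym 0⁻¹≡0) ⟩
    x ⁻¹ * 0# ⁻¹  ∎
  ... | no x≢0 | no y≢0 = sym (⁻¹-unique (x * y) (x ⁻¹ * y ⁻¹) (begin
    x * y * (x ⁻¹ * y ⁻¹)   ≡⟨ solve 4 (λ a b c d → (a :* b :* (c :* d)) := ((a :* c) :* (b :* d))) refl x y (x ⁻¹) (y ⁻¹) ⟩
    x * x ⁻¹ * (y * y ⁻¹)   ≡⟨ cong₂ _*_ (inverseʳ x x≢0) (inverseʳ y y≢0) ⟩
    1# * 1#                 ≡⟨ *-identityˡ 1# ⟩
    1#                      ∎))

  c*x≡x⇒x≡0 : ∀ c x → c ≢ 1# → c * x ≡ x → x ≡ 0#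
  c*x≡x⇒x≡0 c x c≢1 e with x*y≡0⇒x≡0⊎y≡0 {c + - 1#} {x} [c-1]x≡0
    where
    [c-1]x≡0 : (c + - 1#) * x ≡ 0#
    [c-1]x≡0 = begin
      (c + - 1#) * x    ≡⟨ distribʳ x c (- 1#) ⟩
      c * x + - 1# * x  ≡⟨ cong₂ _+_ e (-1*x≈-x x) ⟩
      x + - x           ≡⟨ -‿inverseʳ x ⟩
      0#                ∎
  ... | inj₁ c-1≡0 = ⊥-elim (c≢1 (x-y≡0⇒x≡y c 1# c-1≡0))
  ... | inj₂ x≡0   = x≡0

  x+c≡d⇒y+c≡0⇒x≡d+y : ∀ {x c d y} → x + c ≡ d → y + c ≡ 0# → x ≡ d + y
  x+c≡d⇒y+c≡0⇒x≡d+y {x} {c} {d} {y} x+c≡d y+c≡0 = begin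
    x             ≡⟨ sym (+-identityʳ x) ⟩
    x + 0#        ≡⟨ cong (x +_) (sym y+c≡0) ⟩
    x + (y + c)   ≡⟨ solve 3 (λ x y c → (x :+ (y :+ c)) := ((x :+ c) :+ y)) refl x y c ⟩
    x + c + y     ≡⟨ cong (_+ y) x+c≡d ⟩
    d + y         ∎

  -x*-y≡x*y : ∀ x y → - x * - y ≡ x * y
  -x*-y≡x*y x y = trans (sym (-‿distribˡ-* x (- y))) (trans (cong -_ (sym (-‿distribʳ-* x y))) (-‿involutive _))

  -1*-1≡1 : - 1# * - 1# ≡ 1#
  -1*-1≡1 = trans (-x*-y≡x*y 1# 1#) (*-identityˡ 1#)

  -1≢0 : - 1# ≢ 0#
  -1≢0 e = 1≢0 (trans (sym -1*-1≡1) (trans (cong (_* - 1#) e) (zeroˡ _)))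

  fromℕ-+ : ∀ m n → fromℕ (m ℕ.+ n) ≡ fromℕ m + fromℕ n
  fromℕ-+ zero    n = sym (+-identityˡ _)
  fromℕ-+ (suc m) n = trans (cong (1# +_) (fromℕ-+ m n)) (sym (+-assoc _ _ _))

  1-_ : Carrier → Carrier
  1- s = 1# + - s

  1-[1-s]≡s : ∀ s → 1- (1- s) ≡ s
  1-[1-s]≡s s = begin
    1# + - (1# + - s)    ≡⟨ cong (1# +_) (sym (-‿+-comm 1# (- s))) ⟩
    1# + (- 1# + - - s)  ≡⟨ sym (+-assoc _ _ _) ⟩
    1# + - 1# + - - s    ≡⟨ cong₂ _+_ (-‿inverseʳ 1#) (-‿involutive s) ⟩
    0# + s               ≡⟨ +-identityˡ s ⟩
    s                    ∎

  1-s≢0 : ∀ {s} → s ≢ 1# → 1- s ≢ 0#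
  1-s≢0 s≢1 e = s≢1 (sym (x-y≡0⇒x≡y 1# _ e))

  odds : Carrier → Carrier
  odds s = s / 1- s

  odds-*-odds≡1⇒≡1-s : ∀ s t → s ≢ 0# → s ≢ 1# → odds s * odds t ≡ 1# → t ≡ 1- s
  odds-*-odds≡1⇒≡1-s s t s≢0 s≢1 e = sym (x-y≡0⇒x≡y _ t (x+y≡x⇒y≡0 (s * t) _ (trans (+-comm _ _) (sym (trans st≡ab ab≡)))))
    where
    a = 1- s
    b = 1- t
    b≢0 : b ≢ 0#
    b≢0 b≡0 = 1≢0 (trans (sym e) (begin
      odds s * (t * b ⁻¹)   ≡⟨ cong (λ z → odds s * (t * z ⁻¹)) b≡0 ⟩
      odds s * (t * 0# ⁻¹)  ≡⟨ cong (λ z → odds s * (t * z)) 0⁻¹≡0 ⟩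
      odds s * (t * 0#)     ≡⟨ cong (odds s *_) (zeroʳ t) ⟩
      odds s * 0#           ≡⟨ zeroʳ _ ⟩
      0#                    ∎))
    st≡ab : s * t ≡ a * b
    st≡ab = begin
      s * t                               ≡⟨ sym (*-identityʳ _) ⟩
      s * t * 1#                          ≡⟨ cong (s * t *_) (sym (trans (cong₂ _*_ (inverseˡ a (1-s≢0 s≢1)) (inverseˡ b b≢0)) (*-identityˡ 1#))) ⟩
      s * t * (a ⁻¹ * a * (b ⁻¹ * b))     ≡⟨ solve 6 (λ s t ai a bi b → (s :* t :* (ai :* a :* (bi :* b))) := (s :* ai :* (t :* bi) :* (a :* b))) refl s t (a ⁻¹) a (b ⁻¹) b ⟩
      odds s * odds t * (a * b)           ≡⟨ cong (_* (a * b)) e ⟩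
      1# * (a * b)                        ≡⟨ *-identityˡ _ ⟩
      a * b                               ∎
    ab≡ : a * b ≡ (1# + - s + - t) + s * t
    ab≡ = begin
      (1# + - s) * (1# + - t)                ≡⟨ distribʳ _ _ _ ⟩
      1# * (1# + - t) + - s * (1# + - t)     ≡⟨ cong₂ _+_ (*-identityˡ _) (distribˡ _ _ _) ⟩
      (1# + - t) + (- s * 1# + - s * - t)    ≡⟨ cong₂ (λ u v → (1# + - t) + (u + v)) (*-identityʳ _) (-x*-y≡x*y s t) ⟩
      (1# + - t) + (- s + s * t)             ≡⟨ solve 4 (λ o nt ns st → ((o :+ nt) :+ (ns :+ st)) := ((o :+ ns :+ nt) :+ st)) refl 1# (- t) (- s) (s * t) ⟩
      (1# + - s + - t) + s * t               ∎

  ≡1-s⇒odds-*-odds≡1 : ∀ s → s ≢ 0# → s ≢ 1# → odds s * odds (1- s) ≡ 1#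
  ≡1-s⇒odds-*-odds≡1 s s≢0 s≢1 = begin
    s * a ⁻¹ * (a * (1- a) ⁻¹)  ≡⟨ cong (λ z → s * a ⁻¹ * (a * z ⁻¹)) (1-[1-s]≡s s) ⟩
    s * a ⁻¹ * (a * s ⁻¹)       ≡⟨ solve 4 (λ s ai a si → (s :* ai :* (a :* si)) := ((s :* si) :* (a :* ai))) refl s (a ⁻¹) a (s ⁻¹) ⟩
    s * s ⁻¹ * (a * a ⁻¹)       ≡⟨ cong₂ _*_ (inverseʳ s s≢0) (inverseʳ a (1-s≢0 s≢1)) ⟩
    1# * 1#                     ≡⟨ *-identityˡ 1# ⟩
    1#                          ∎
    where a = 1- s

  odds/-1≢1 : ∀ s → odds s / - 1# ≢ 1#
  odds/-1≢1 s e = -1≢0 (x+y≡x⇒y≡0 s (- 1#) (trans (+-comm _ _) (sym s≡-1+s)))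
    where
    a = 1- s
    a≢0 : a ≢ 0#
    a≢0 a≡0 = 1≢0 (trans (sym e) (begin
      s * a ⁻¹ * (- 1#) ⁻¹   ≡⟨ cong (λ z → s * z ⁻¹ * (- 1#) ⁻¹) a≡0 ⟩
      s * 0# ⁻¹ * (- 1#) ⁻¹  ≡⟨ cong (λ z → s * z * (- 1#) ⁻¹) 0⁻¹≡0 ⟩
      s * 0# * (- 1#) ⁻¹     ≡⟨ cong (_* (- 1#) ⁻¹) (zeroʳ s) ⟩
      0# * (- 1#) ⁻¹         ≡⟨ zeroˡ _ ⟩
      0#                     ∎))
    s≡-1+s : s ≡ - 1# + s
    s≡-1+s = begin
      s                                        ≡⟨ sym (*-identityʳ s) ⟩
      s * 1#                                   ≡⟨ cong (s *_) (sym (trans (cong₂ _*_ (inverseˡ a a≢0) (inverseˡ (- 1#) -1≢0)) (*-identityˡ 1#))) ⟩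
      s * (a ⁻¹ * a * ((- 1#) ⁻¹ * - 1#))      ≡⟨ solve 5 (λ s ai a mi m → (s :* (ai :* a :* (mi :* m))) := (s :* ai :* mi :* (a :* m))) refl s (a ⁻¹) a ((- 1#) ⁻¹) (- 1#) ⟩
      odds s / - 1# * (a * - 1#)               ≡⟨ cong (_* (a * - 1#)) e ⟩
      1# * (a * - 1#)                          ≡⟨ *-identityˡ _ ⟩
      (1# + - s) * - 1#                        ≡⟨ distribʳ _ _ _ ⟩
      1# * - 1# + - s * - 1#                   ≡⟨ cong₂ _+_ (*-identityˡ _) (trans (-x*-y≡x*y s 1#) (*-identityʳ s)) ⟩
      - 1# + s                                 ∎

module Sums (F : FiniteField) (K : CharZeroField) where
  open FieldProperties (CharZeroField.field′ K)
  open ≡-Reasoning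

  ∑ : ∀ {A : Set} → List A → (A → Carrier) → Carrier
  ∑ = sumL F K

  ∑-cong-∈ : ∀ {A : Set} (xs : List A) {f h : A → Carrier} → (∀ a → a ∈ xs → f a ≡ h a) → ∑ xs f ≡ ∑ xs h
  ∑-cong-∈ []       p = refl
  ∑-cong-∈ (x ∷ xs) p = cong₂ _+_ (p x (here refl)) (∑-cong-∈ xs (λ a a∈ → p a (there a∈)))

  ∑-cong : ∀ {A : Set} (xs : List A) {f h : A → Carrier} → (∀ a → f a ≡ h a) → ∑ xs f ≡ ∑ xs h
  ∑-cong xs p = ∑-cong-∈ xs (λ a _ → p a)

  ∑-zero : ∀ {A : Set} (xs : List A) {f : A → Carrier} → (∀ a → f a ≡ 0#) → ∑ xs f ≡ 0#
  ∑-zero []       p = refl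
  ∑-zero (x ∷ xs) p = trans (cong₂ _+_ (p x) (∑-zero xs p)) (+-identityˡ 0#)

  ∑-distrib-+ : ∀ {A : Set} (xs : List A) (f h : A → Carrier) → ∑ xs (λ a → f a + h a) ≡ ∑ xs f + ∑ xs h
  ∑-distrib-+ []       f h = sym (+-identityˡ 0#)
  ∑-distrib-+ (x ∷ xs) f h = trans (cong ((f x + h x) +_) (∑-distrib-+ xs f h))
    (solve 4 (λ a b c d → ((a :+ b) :+ (c :+ d)) := ((a :+ c) :+ (b :+ d))) refl (f x) (h x) (∑ xs f) (∑ xs h))

  *-distribˡ-∑ : ∀ {A : Set} (xs : List A) (c : Carrier) (f : A → Carrier) → c * ∑ xs f ≡ ∑ xs (λ a → c * f a)
  *-distribˡ-∑ []       c f = zeroʳ c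
  *-distribˡ-∑ (x ∷ xs) c f = trans (distribˡ c (f x) (∑ xs f)) (cong (c * f x +_) (*-distribˡ-∑ xs c f))

  *-distribʳ-∑ : ∀ {A : Set} (xs : List A) (c : Carrier) (f : A → Carrier) → ∑ xs f * c ≡ ∑ xs (λ a → f a * c)
  *-distribʳ-∑ xs c f = trans (*-comm _ c) (trans (*-distribˡ-∑ xs c f) (∑-cong xs (λ a → *-comm c (f a))))

  ∑-comm : ∀ {A B : Set} (xs : List A) (ys : List B) (f : A → B → Carrier) →
           ∑ xs (λ a → ∑ ys (f a)) ≡ ∑ ys (λ b → ∑ xs (λ a → f a b))
  ∑-comm []       ys f = sym (∑-zero ys (λ _ → refl))
  ∑-comm (x ∷ xs) ys f = trans (cong (∑ ys (f x) +_) (∑-comm xs ys f))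
                                (sym (∑-distrib-+ ys (f x) (λ b → ∑ xs (λ a → f a b))))

  ∑-one : ∀ {A : Set} (xs : List A) → ∑ xs (λ _ → 1#) ≡ fromℕ (length xs)
  ∑-one []       = refl
  ∑-one (x ∷ xs) = cong (1# +_) (∑-one xs)

  ∑-fromℕ : ∀ {A : Set} (xs : List A) (f : A → Carrier) → (∀ a → ∃ λ n → f a ≡ fromℕ n) → ∃ λ m → ∑ xs f ≡ fromℕ m
  ∑-fromℕ []       f p = 0 , refl
  ∑-fromℕ (x ∷ xs) f p with p x | ∑-fromℕ xs f p
  ... | n , fx≡n | m , ∑≡m = n ℕ.+ m , trans (cong₂ _+_ fx≡n ∑≡m) (sym (fromℕ-+ n m))

  𝟙 : ∀ {P : Set} → Dec P → Carrier
  𝟙 (yes _) = 1#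
  𝟙 (no _)  = 0#

  𝟙-yes : ∀ {P : Set} (d : Dec P) → P → 𝟙 d ≡ 1#
  𝟙-yes (yes _) _ = refl
  𝟙-yes (no ¬p) p = ⊥-elim (¬p p)

  𝟙-no : ∀ {P : Set} (d : Dec P) → ¬ P → 𝟙 d ≡ 0#
  𝟙-no (yes p) ¬p = ⊥-elim (¬p p)
  𝟙-no (no _)  _  = refl

  𝟙-fromℕ : ∀ {P : Set} (d : Dec P) → ∃ λ n → 𝟙 d ≡ fromℕ n
  𝟙-fromℕ (yes _) = 1 , sym (+-identityʳ 1#)
  𝟙-fromℕ (no _)  = 0 , refl

  𝟙-⇔ : ∀ {P Q : Set} (d : Dec P) (e : Dec Q) → (P → Q) → (Q → P) → 𝟙 d ≡ 𝟙 e
  𝟙-⇔ (yes p) (yes q) f g = refl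
  𝟙-⇔ (yes p) (no ¬q) f g = ⊥-elim (¬q (f p))
  𝟙-⇔ (no ¬p) (yes q) f g = ⊥-elim (¬p (g q))
  𝟙-⇔ (no ¬p) (no ¬q) f g = refl

  module Selection {A : Set} (R : A → A → Set) (R? : ∀ a b → Dec (R a b))
                   (R-join : ∀ {a b c} → R a c → R b c → R a b) where

    ∑-𝟙-none : (xs : List A) (z : A) (f : A → Carrier) → (∀ a → a ∈ xs → ¬ R a z) →
               ∑ xs (λ a → 𝟙 (R? a z) * f a) ≡ 0#
    ∑-𝟙-none []       z f p = refl
    ∑-𝟙-none (x ∷ xs) z f p with R? x z
    ... | yes r = ⊥-elim (p x (here refl) r)
    ... | no _  = trans (cong₂ _+_ (zeroˡ (f x)) (∑-𝟙-none xs z f (λ a a∈ → p a (there a∈)))) (+-identityˡ 0#)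

    ∑-𝟙-unique : (xs : List A) → AllPairs (λ a b → ¬ R a b) xs → (z : A) → (∃ λ a → a ∈ xs × R a z) →
                 (f : A → Carrier) → (∀ a → R a z → f a ≡ f z) →
                 ∑ xs (λ a → 𝟙 (R? a z) * f a) ≡ f z
    ∑-𝟙-unique []       _ z (a , () , _) f fz
    ∑-𝟙-unique (x ∷ xs) (x≁ ∷ distinct) z (a , a∈ , r) f fz with R? x z
    ... | yes rx = begin
        1# * f x + ∑ xs (λ a → 𝟙 (R? a z) * f a)
          ≡⟨ cong₂ _+_ (trans (*-identityˡ _) (fz x rx))
                       (∑-𝟙-none xs z f (λ b b∈ rb → ListAll.lookup x≁ b∈ (R-join rx rb))) ⟩
        f z + 0# ≡⟨ +-identityʳ _ ⟩
        f z ∎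
    ∑-𝟙-unique (x ∷ xs) (_ ∷ distinct) z (a , here refl , r) f fz | no ¬rx = ⊥-elim (¬rx r)
    ∑-𝟙-unique (x ∷ xs) (_ ∷ distinct) z (a , there a∈ , r) f fz | no ¬rx =
        trans (cong₂ _+_ (zeroˡ (f x)) (∑-𝟙-unique xs distinct z (a , a∈ , r) f fz)) (+-identityˡ _)

  prodV-∷ʳ : ∀ {n} (xs : Vec (Fun F K) n) (a : Fun F K) (f : Fun F K → Carrier) → prodV F K (xs ∷ʳ a) f ≡ prodV F K xs f * f a
  prodV-∷ʳ []       a f = trans (*-identityʳ _) (sym (*-identityˡ _))
  prodV-∷ʳ (y ∷ xs) a f = trans (cong (f y *_) (prodV-∷ʳ xs a f)) (sym (*-assoc _ _ _))

module Characters (F : FiniteField) (K : CharZeroField) where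
  module 𝔽 = FieldProperties (FiniteField.field′ F)
  open 𝔽 public using ()
    renaming (_+_ to _+ᶠ_; _*_ to _*ᶠ_; -_ to -ᶠ_; 0# to 0ᶠ; 1# to 1ᶠ; _⁻¹ to _⁻¹ᶠ; _≟_ to _≟ᶠ_; 1-_ to 1ᶠ-_)
  open Sums F K public
  open FieldProperties (CharZeroField.field′ K) public
  open FiniteField F public using (elems; unique; complete; q)
  open ≡-Reasoning

  Fq : Set
  Fq = FiniteField.Carrier F

  Fn : Set
  Fn = Fun F K

  infixl 7 _∙_
  _∙_ : Fn → Fn → Fn
  _∙_ = _·_ F K

  inv′ : Fn → Fn
  inv′ = inv F K

  ε′ : Fn
  ε′ = ε F K

  -1ᶠ : Fq
  -1ᶠ = -ᶠ 1ᶠ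

  ∑-𝟙-≡ : (z : Fq) (f : Fq → Carrier) → ∑ elems (λ x → 𝟙 (x ≟ᶠ z) * f x) ≡ f z
  ∑-𝟙-≡ z f = ∑-𝟙-unique elems unique z (z , complete z , refl) f (λ a e → cong f e)
    where open Selection {Fq} _≡_ _≟ᶠ_ (λ p q → trans p (sym q))

  ∑-bijection : (h h′ : Fq → Fq) → (∀ x → h′ (h x) ≡ x) → (∀ y → h (h′ y) ≡ y) →
                (f : Fq → Carrier) → ∑ elems (λ x → f (h x)) ≡ ∑ elems f
  ∑-bijection h h′ h′∘h h∘h′ f = begin
    ∑ elems (λ x → f (h x))                              ≡⟨ ∑-cong elems (λ x → sym (∑-𝟙-≡ (h x) f)) ⟩
    ∑ elems (λ x → ∑ elems (λ y → 𝟙 (y ≟ᶠ h x) * f y))   ≡⟨ ∑-comm elems elems _ ⟩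
    ∑ elems (λ y → ∑ elems (λ x → 𝟙 (y ≟ᶠ h x) * f y))   ≡⟨ ∑-cong elems (λ y → ∑-cong elems (λ x → cong (_* f y)
                                                              (𝟙-⇔ (y ≟ᶠ h x) (x ≟ᶠ h′ y)
                                                                   (λ e → trans (sym (h′∘h x)) (cong h′ (sym e)))
                                                                   (λ e → trans (sym (h∘h′ y)) (cong h (sym e)))))) ⟩
    ∑ elems (λ y → ∑ elems (λ x → 𝟙 (x ≟ᶠ h′ y) * f y))  ≡⟨ ∑-cong elems (λ y → ∑-𝟙-≡ (h′ y) (λ _ → f y)) ⟩
    ∑ elems f                                            ∎

  ∑-translate : ∀ b (f : Fq → Carrier) → ∑ elems (λ x → f (b +ᶠ x)) ≡ ∑ elems f
  ∑-translate b f = ∑-bijection (b +ᶠ_) (-ᶠ b +ᶠ_) cancel cancel′ f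
    where
    cancel : ∀ x → -ᶠ b +ᶠ (b +ᶠ x) ≡ x
    cancel x = trans (sym (𝔽.+-assoc _ _ _)) (trans (cong (_+ᶠ x) (𝔽.-‿inverseˡ b)) (𝔽.+-identityˡ x))
    cancel′ : ∀ x → b +ᶠ (-ᶠ b +ᶠ x) ≡ x
    cancel′ x = trans (sym (𝔽.+-assoc _ _ _)) (trans (cong (_+ᶠ x) (𝔽.-‿inverseʳ b)) (𝔽.+-identityˡ x))

  ∑-dilate : ∀ a → a ≢ 0ᶠ → (f : Fq → Carrier) → ∑ elems (λ x → f (a *ᶠ x)) ≡ ∑ elems f
  ∑-dilate a a≢0 f = ∑-bijection (a *ᶠ_) (a ⁻¹ᶠ *ᶠ_) cancel cancel′ f
    where
    cancel : ∀ x → a ⁻¹ᶠ *ᶠ (a *ᶠ x) ≡ x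
    cancel x = trans (sym (𝔽.*-assoc _ _ _)) (trans (cong (_*ᶠ x) (𝔽.inverseˡ a a≢0)) (𝔽.*-identityˡ x))
    cancel′ : ∀ x → a *ᶠ (a ⁻¹ᶠ *ᶠ x) ≡ x
    cancel′ x = trans (sym (𝔽.*-assoc _ _ _)) (trans (cong (_*ᶠ x) (𝔽.inverseʳ a a≢0)) (𝔽.*-identityˡ x))

  q≡2+ : ∃ λ m → q ≡ suc (suc m)
  q≡2+ = go elems unique (complete 0ᶠ) (complete 1ᶠ)
    where
    go : (xs : List Fq) → AllPairs _≢_ xs → 0ᶠ ∈ xs → 1ᶠ ∈ xs → ∃ λ m → length xs ≡ suc (suc m)
    go (x ∷ [])     _ (here refl) (here 1≡0) = ⊥-elim (𝔽.1≢0 1≡0)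
    go (x ∷ [])     _ (here _)    (there ())
    go (x ∷ [])     _ (there ())  _
    go (x ∷ y ∷ xs) _ _           _          = length xs , refl

  q-1 : Carrier
  q-1 = fromℕ (q ∸ 1)

  q-1+1≡q : q-1 + 1# ≡ fromℕ q
  q-1+1≡q with q≡2+
  ... | m , e rewrite e = +-comm _ _

  q-1≢0 : q-1 ≢ 0#
  q-1≢0 with q≡2+
  ... | m , e rewrite e = CharZeroField.charZero K m

  q≢0 : fromℕ q ≢ 0#
  q≢0 with q≡2+
  ... | m , e rewrite e = CharZeroField.charZero K (suc m)

  module MultChar {χ : Fn} (χ-char : IsMultChar F K χ) where
    open IsMultChar χ-char

    χ≢0 : ∀ {x} → x ≢ 0ᶠ → χ x ≢ 0#
    χ≢0 {x} x≢0 χx≡0 = 1≢0 (begin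
      1#                 ≡⟨ sym at1 ⟩
      χ 1ᶠ               ≡⟨ cong χ (sym (𝔽.inverseʳ x x≢0)) ⟩
      χ (x *ᶠ x ⁻¹ᶠ)     ≡⟨ mult _ _ ⟩
      χ x * χ (x ⁻¹ᶠ)    ≡⟨ cong (_* χ (x ⁻¹ᶠ)) χx≡0 ⟩
      0# * χ (x ⁻¹ᶠ)     ≡⟨ zeroˡ _ ⟩
      0#                 ∎)

    χ-⁻¹ : ∀ x → χ (x ⁻¹ᶠ) ≡ χ x ⁻¹
    χ-⁻¹ x with x ≟ᶠ 0ᶠ
    ... | yes refl = trans (cong χ 𝔽.0⁻¹≡0) (trans at0 (trans (sym 0⁻¹≡0) (cong _⁻¹ (sym at0))))
    ... | no x≢0   = ⁻¹-unique (χ x) (χ (x ⁻¹ᶠ)) (trans (sym (mult _ _)) (trans (cong χ (𝔽.inverseʳ x x≢0)) at1))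

    χ-/ : ∀ a b → χ a * χ b ⁻¹ ≡ χ (a *ᶠ b ⁻¹ᶠ)
    χ-/ a b = trans (cong (χ a *_) (sym (χ-⁻¹ b))) (sym (mult a _))

    χ[-1]²≡1 : χ -1ᶠ * χ -1ᶠ ≡ 1#
    χ[-1]²≡1 = trans (sym (mult _ _)) (trans (cong χ 𝔽.-1*-1≡1) at1)

    χ[-1]⁻¹≡χ[-1] : χ -1ᶠ ⁻¹ ≡ χ -1ᶠ
    χ[-1]⁻¹≡χ[-1] = sym (⁻¹-unique _ _ χ[-1]²≡1)

    χ-neg : ∀ x → χ (-ᶠ x) ≡ χ -1ᶠ * χ x
    χ-neg x = trans (cong χ (sym (𝔽.-1*x≈-x x))) (mult _ _)

    χ*χ⁻¹-cancel : ∀ x r → (x ≡ 0ᶠ → r ≡ 0#) → χ x * χ x ⁻¹ * r ≡ r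
    χ*χ⁻¹-cancel x r r-vanishes with x ≟ᶠ 0ᶠ
    ... | yes x≡0 = trans (cong (χ x * χ x ⁻¹ *_) (r-vanishes x≡0)) (trans (zeroʳ _) (sym (r-vanishes x≡0)))
    ... | no x≢0  = trans (cong (_* r) (inverseʳ _ (χ≢0 x≢0))) (*-identityˡ r)

  open MultChar public

  ∙-char : ∀ {χ ψ} → IsMultChar F K χ → IsMultChar F K ψ → IsMultChar F K (χ ∙ ψ)
  ∙-char {χ} {ψ} χ-char ψ-char = record
    { at0  = trans (cong (_* ψ 0ᶠ) (IsMultChar.at0 χ-char)) (zeroˡ _)
    ; at1  = trans (cong₂ _*_ (IsMultChar.at1 χ-char) (IsMultChar.at1 ψ-char)) (*-identityˡ 1#)
    ; mult = λ x y → trans (cong₂ _*_ (IsMultChar.mult χ-char x y) (IsMultChar.mult ψ-char x y))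
        (solve 4 (λ a b e f → ((a :* b) :* (e :* f)) := ((a :* e) :* (b :* f))) refl (χ x) (χ y) (ψ x) (ψ y))
    }

  inv-char : ∀ {χ} → IsMultChar F K χ → IsMultChar F K (inv′ χ)
  inv-char χ-char = record
    { at0  = trans (cong _⁻¹ (IsMultChar.at0 χ-char)) 0⁻¹≡0
    ; at1  = trans (cong _⁻¹ (IsMultChar.at1 χ-char)) 1⁻¹≡1
    ; mult = λ x y → trans (cong _⁻¹ (IsMultChar.mult χ-char x y)) (⁻¹-distrib-* _ _)
    }

  ε′-nonzero : ∀ {x} → x ≢ 0ᶠ → ε′ x ≡ 1#
  ε′-nonzero {x} x≢0 with x ≟ᶠ 0ᶠ
  ... | yes x≡0 = ⊥-elim (x≢0 x≡0)
  ... | no _    = refl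

  ε′-zero : ε′ 0ᶠ ≡ 0#
  ε′-zero with 0ᶠ ≟ᶠ 0ᶠ
  ... | yes _  = refl
  ... | no 0≢0 = ⊥-elim (0≢0 refl)

  ε′-char : IsMultChar F K ε′
  ε′-char = record { at0 = ε′-zero ; at1 = ε′-nonzero 𝔽.1≢0 ; mult = ε′-mult }
    where
    ε′-mult : ∀ x y → ε′ (x *ᶠ y) ≡ ε′ x * ε′ y
    ε′-mult x y with x ≟ᶠ 0ᶠ | y ≟ᶠ 0ᶠ | (x *ᶠ y) ≟ᶠ 0ᶠ
    ... | yes _    | _        | yes _   = sym (zeroˡ _)
    ... | yes refl | _        | no xy≢0 = ⊥-elim (xy≢0 (𝔽.zeroˡ y))
    ... | no _     | yes _    | yes _   = sym (zeroʳ _)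
    ... | no _     | yes refl | no xy≢0 = ⊥-elim (xy≢0 (𝔽.zeroʳ x))
    ... | no x≢0   | no y≢0   | yes xy≡0 = ⊥-elim (𝔽.x*y≢0 x≢0 y≢0 xy≡0)
    ... | no _     | no _     | no _    = sym (*-identityˡ 1#)

  ε′+𝟙[≡0]≡1 : ∀ x → ε′ x + 𝟙 (x ≟ᶠ 0ᶠ) ≡ 1#
  ε′+𝟙[≡0]≡1 x with x ≟ᶠ 0ᶠ
  ... | yes _ = +-identityˡ 1#
  ... | no _  = +-identityʳ 1#

  ε′²≡ε′ : ∀ x → ε′ x * ε′ x ≡ ε′ x
  ε′²≡ε′ x with x ≟ᶠ 0ᶠ
  ... | yes _ = zeroˡ _
  ... | no _  = *-identityˡ _

  infix 4 _≈_ _≈?_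
  _≈_ : Fn → Fn → Set
  φ ≈ ψ = ∀ x → φ x ≡ ψ x

  _≈?_ : (φ ψ : Fn) → Dec (φ ≈ ψ)
  φ ≈? ψ with ListAll.all? (λ x → φ x ≟ ψ x) elems
  ... | yes all≡ = yes (λ x → ListAll.lookup all≡ (complete x))
  ... | no ¬all≡ = no (λ φ≈ψ → ¬all≡ (ListAll.tabulate (λ {x} _ → φ≈ψ x)))

  ≉⇒witness : ∀ {φ ψ} → ¬ φ ≈ ψ → ∃ λ x → φ x ≢ ψ x
  ≉⇒witness {φ} {ψ} φ≉ψ =
    satisfied (¬All⇒Any¬ (λ x → φ x ≟ ψ x) elems (λ all≡ → φ≉ψ (λ x → ListAll.lookup all≡ (complete x))))

  inv-ε′ : ∀ {χ} → χ ≈ ε′ → inv′ χ ≈ ε′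
  inv-ε′ {χ} χ≈ε x with x ≟ᶠ 0ᶠ | χ≈ε x
  ... | yes _ | e = trans (cong _⁻¹ e) 0⁻¹≡0
  ... | no _  | e = trans (cong _⁻¹ e) 1⁻¹≡1

  -- δ tests χ x ≟ ε x along elems by a where-bound function that cannot be named;
  -- the meta δ-test is solved to that function by with-abstracting elems.
  module DeltaTest (χ : Fn) where
    δ-test-type : ∀ {b : Bool} → (if b then 1# else 0#) ≡ δ F K χ → (if b then 1# else 0#) ≡ δ F K χ
    δ-test-type e = e
    mutual
      δ-test : List Fq → Bool
      δ-test ys = _

      δ-unfolds : Σ (List Fq) (λ ys → (if δ-test ys then 1# else 0#) ≡ δ F K χ)
      δ-unfolds with elems | δ-test-type refl
      ... | ys | e = ys , e

  open DeltaTest using (δ-test)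

  δ-test-true : ∀ χ xs → δ-test χ xs ≡ true → ListAll (λ x → χ x ≡ ε′ x) xs
  δ-test-true χ []       e = []
  δ-test-true χ (x ∷ xs) e with χ x ≟ ε′ x
  ... | yes p = p ∷ δ-test-true χ xs e
  ... | no _ with e
  ... | ()

  δ-test-false : ∀ χ xs → δ-test χ xs ≡ false → ¬ ListAll (λ x → χ x ≡ ε′ x) xs
  δ-test-false χ []       () _
  δ-test-false χ (x ∷ xs) e (p ∷ ps) with χ x ≟ ε′ x
  ... | yes _ = δ-test-false χ xs e ps
  ... | no ¬p = ¬p p

  δ≡𝟙[≈ε] : ∀ χ → δ F K χ ≡ 𝟙 (χ ≈? ε′)
  δ≡𝟙[≈ε] χ with δ-test χ elems in e | χ ≈? ε′
  ... | true  | yes _  = refl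
  ... | true  | no χ≉ε = ⊥-elim (χ≉ε (λ x → ListAll.lookup (δ-test-true χ elems e) (complete x)))
  ... | false | yes χ≈ε = ⊥-elim (δ-test-false χ elems e (ListAll.tabulate (λ {x} _ → χ≈ε x)))
  ... | false | no _   = refl

  δ-cong : ∀ {φ ψ} → φ ≈ ψ → δ F K φ ≡ δ F K ψ
  δ-cong {φ} {ψ} φ≈ψ = trans (δ≡𝟙[≈ε] φ) (trans (𝟙-⇔ (φ ≈? ε′) (ψ ≈? ε′)
    (λ φ≈ε x → trans (sym (φ≈ψ x)) (φ≈ε x)) (λ ψ≈ε x → trans (φ≈ψ x) (ψ≈ε x))) (sym (δ≡𝟙[≈ε] ψ)))

  δ-inv : ∀ χ → δ F K (inv′ χ) ≡ δ F K χ
  δ-inv χ = trans (δ≡𝟙[≈ε] _) (trans (𝟙-⇔ (inv′ χ ≈? ε′) (χ ≈? ε′)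
    (λ χ̄≈ε x → trans (sym (⁻¹-involutive (χ x))) (inv-ε′ χ̄≈ε x)) inv-ε′) (sym (δ≡𝟙[≈ε] χ)))

  ∑ε′≡q-1 : ∑ elems ε′ ≡ q-1
  ∑ε′≡q-1 = +-cancelˡ 1# _ _ (begin
    1# + ∑ elems ε′                                        ≡⟨ +-comm _ _ ⟩
    ∑ elems ε′ + 1#                                        ≡⟨ cong (∑ elems ε′ +_) (sym (∑-𝟙-≡ 0ᶠ (λ _ → 1#))) ⟩
    ∑ elems ε′ + ∑ elems (λ x → 𝟙 (x ≟ᶠ 0ᶠ) * 1#)         ≡⟨ sym (∑-distrib-+ elems _ _) ⟩
    ∑ elems (λ x → ε′ x + 𝟙 (x ≟ᶠ 0ᶠ) * 1#)                ≡⟨ ∑-cong elems (λ x → trans (cong (ε′ x +_) (*-identityʳ _)) (ε′+𝟙[≡0]≡1 x)) ⟩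
    ∑ elems (λ _ → 1#)                                     ≡⟨ ∑-one elems ⟩
    fromℕ q                                                ≡⟨ sym q-1+1≡q ⟩
    q-1 + 1#                                               ≡⟨ +-comm _ _ ⟩
    1# + q-1                                               ∎)

  ∑χ≡[q-1]δ : ∀ {χ} → IsMultChar F K χ → ∑ elems χ ≡ q-1 * δ F K χ
  ∑χ≡[q-1]δ {χ} χ-char rewrite δ≡𝟙[≈ε] χ with χ ≈? ε′
  ... | yes χ≈ε = trans (∑-cong elems χ≈ε) (trans ∑ε′≡q-1 (sym (*-identityʳ q-1)))
  ... | no χ≉ε with ≉⇒witness χ≉ε
  ... | a , χa≢εa = trans (c*x≡x⇒x≡0 (χ a) _ χa≢1 χa∑χ≡∑χ) (sym (zeroʳ q-1))
    where
    a≢0 : a ≢ 0ᶠ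
    a≢0 refl = χa≢εa (trans (IsMultChar.at0 χ-char) (sym ε′-zero))
    χa≢1 : χ a ≢ 1#
    χa≢1 e = χa≢εa (trans e (sym (ε′-nonzero a≢0)))
    χa∑χ≡∑χ : χ a * ∑ elems χ ≡ ∑ elems χ
    χa∑χ≡∑χ = trans (*-distribˡ-∑ elems (χ a) χ)
                (trans (∑-cong elems (λ x → sym (IsMultChar.mult χ-char a x))) (∑-dilate a a≢0 χ))

module CharacterGroup (F : FiniteField) (K : CharZeroField) (chars : List (Fun F K)) (cg : IsCharGroup F K chars) where
  open Characters F K public
  open IsCharGroup cg renaming (complete to chars-complete)
  open ≡-Reasoning

  Respects-≈ : (Fn → Carrier) → Set
  Respects-≈ f = ∀ φ ψ → φ ≈ ψ → f φ ≡ f ψ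

  ∑-𝟙-≈ : ∀ z → IsMultChar F K z → (f : Fn → Carrier) → Respects-≈ f →
          ∑ chars (λ ψ → 𝟙 (ψ ≈? z) * f ψ) ≡ f z
  ∑-𝟙-≈ z z-char f f-resp with chars-complete z z-char
  ... | ψ , ψ∈ , z≈ψ = ∑-𝟙-unique chars distinct z (ψ , ψ∈ , (λ x → sym (z≈ψ x))) f (λ a a≈z → f-resp a z a≈z)
    where open Selection {Fn} _≈_ _≈?_ (λ p r x → trans (p x) (sym (r x)))

  ≈-∙-transpose : ∀ {φ ψ ψ′} → IsMultChar F K φ → IsMultChar F K ψ → IsMultChar F K ψ′ →
                  ψ′ ≈ φ ∙ ψ → ψ ≈ inv′ φ ∙ ψ′
  ≈-∙-transpose {φ} {ψ} {ψ′} φ-char ψ-char ψ′-char e x with x ≟ᶠ 0ᶠ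
  ... | yes refl = trans (IsMultChar.at0 ψ-char)
                     (sym (trans (cong (φ 0ᶠ ⁻¹ *_) (IsMultChar.at0 ψ′-char)) (zeroʳ _)))
  ... | no x≢0 = sym (begin
      φ x ⁻¹ * ψ′ x          ≡⟨ cong (φ x ⁻¹ *_) (e x) ⟩
      φ x ⁻¹ * (φ x * ψ x)   ≡⟨ sym (*-assoc _ _ _) ⟩
      φ x ⁻¹ * φ x * ψ x     ≡⟨ cong (_* ψ x) (inverseˡ (φ x) (χ≢0 φ-char x≢0)) ⟩
      1# * ψ x               ≡⟨ *-identityˡ _ ⟩
      ψ x                    ∎)

  ∑-chars-translate : ∀ φ → IsMultChar F K φ → (f : Fn → Carrier) → Respects-≈ f →
                      ∑ chars (λ ψ → f (φ ∙ ψ)) ≡ ∑ chars f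
  ∑-chars-translate φ φ-char f f-resp = begin
    ∑ chars (λ ψ → f (φ ∙ ψ))
      ≡⟨ ∑-cong-∈ chars (λ ψ ψ∈ → sym (∑-𝟙-≈ (φ ∙ ψ) (∙-char φ-char (members ψ∈)) f f-resp)) ⟩
    ∑ chars (λ ψ → ∑ chars (λ ψ′ → 𝟙 (ψ′ ≈? φ ∙ ψ) * f ψ′))
      ≡⟨ ∑-comm chars chars _ ⟩
    ∑ chars (λ ψ′ → ∑ chars (λ ψ → 𝟙 (ψ′ ≈? φ ∙ ψ) * f ψ′))
      ≡⟨ ∑-cong-∈ chars (λ ψ′ ψ′∈ → ∑-cong-∈ chars (λ ψ ψ∈ → cong (_* f ψ′)
           (𝟙-⇔ (ψ′ ≈? φ ∙ ψ) (ψ ≈? inv′ φ ∙ ψ′)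
                (≈-∙-transpose φ-char (members ψ∈) (members ψ′∈))
                (untranspose (members ψ∈) (members ψ′∈))))) ⟩
    ∑ chars (λ ψ′ → ∑ chars (λ ψ → 𝟙 (ψ ≈? inv′ φ ∙ ψ′) * f ψ′))
      ≡⟨ ∑-cong-∈ chars (λ ψ′ ψ′∈ → ∑-𝟙-≈ (inv′ φ ∙ ψ′) (∙-char (inv-char φ-char) (members ψ′∈)) (λ _ → f ψ′) (λ _ _ _ → refl)) ⟩
    ∑ chars f ∎
    where
    untranspose : ∀ {ψ ψ′} → IsMultChar F K ψ → IsMultChar F K ψ′ → ψ ≈ inv′ φ ∙ ψ′ → ψ′ ≈ φ ∙ ψ
    untranspose ψ-char ψ′-char e x =
      trans (≈-∙-transpose (inv-char φ-char) ψ′-char ψ-char e x) (cong (_* _) (⁻¹-involutive (φ x)))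

  ∑ψ : Fq → Carrier
  ∑ψ y = ∑ chars (λ ψ → ψ y)

  AllTrivialAt : Fq → Set
  AllTrivialAt y = ListAll (λ ψ → ψ y ≡ 1#) chars

  allTrivialAt? : ∀ y → Dec (AllTrivialAt y)
  allTrivialAt? y = ListAll.all? (λ ψ → ψ y ≟ 1#) chars

  allTrivialAt-1 : AllTrivialAt 1ᶠ
  allTrivialAt-1 = ListAll.tabulate (λ ψ∈ → IsMultChar.at1 (members ψ∈))

  ∑-chars-one : ∑ chars (λ _ → 1#) ≡ q-1
  ∑-chars-one = trans (∑-one chars) (cong fromℕ size)

  -- ∑ψ y is fixed by multiplication with every φ y, so it vanishes unless all φ y = 1.
  ∑ψ≡[q-1]𝟙[AllTrivialAt] : ∀ y → ∑ψ y ≡ q-1 * 𝟙 (allTrivialAt? y)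
  ∑ψ≡[q-1]𝟙[AllTrivialAt] y with allTrivialAt? y
  ... | yes all1 = trans (∑-cong-∈ chars (λ ψ ψ∈ → ListAll.lookup all1 ψ∈)) (trans ∑-chars-one (sym (*-identityʳ q-1)))
  ... | no ¬all1 with find (¬All⇒Any¬ (λ ψ → ψ y ≟ 1#) chars ¬all1)
  ... | φ , φ∈ , φy≢1 = trans (c*x≡x⇒x≡0 (φ y) (∑ψ y) φy≢1 φy∑ψ≡∑ψ) (sym (zeroʳ q-1))
    where
    φy∑ψ≡∑ψ : φ y * ∑ψ y ≡ ∑ψ y
    φy∑ψ≡∑ψ = trans (*-distribˡ-∑ chars (φ y) (λ ψ → ψ y))
                    (∑-chars-translate φ (members φ∈) (λ ψ → ψ y) (λ _ _ e → e y))

  ∑∑ψ≡q-1 : ∑ elems ∑ψ ≡ q-1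
  ∑∑ψ≡q-1 = begin
    ∑ elems ∑ψ                                   ≡⟨ ∑-comm elems chars (λ x ψ → ψ x) ⟩
    ∑ chars (λ ψ → ∑ elems ψ)                    ≡⟨ ∑-cong-∈ chars (λ ψ ψ∈ → trans (∑χ≡[q-1]δ (members ψ∈)) (cong (q-1 *_) (δ≡𝟙[≈ε] ψ))) ⟩
    ∑ chars (λ ψ → q-1 * 𝟙 (ψ ≈? ε′))            ≡⟨ sym (*-distribˡ-∑ chars q-1 _) ⟩
    q-1 * ∑ chars (λ ψ → 𝟙 (ψ ≈? ε′))            ≡⟨ cong (q-1 *_) (∑-cong chars (λ ψ → sym (*-identityʳ _))) ⟩
    q-1 * ∑ chars (λ ψ → 𝟙 (ψ ≈? ε′) * 1#)       ≡⟨ cong (q-1 *_) (∑-𝟙-≈ ε′ ε′-char (λ _ → 1#) (λ _ _ _ → refl)) ⟩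
    q-1 * 1#                                     ≡⟨ *-identityʳ q-1 ⟩
    q-1                                          ∎

  ∑𝟙[AllTrivialAt]≡1 : ∑ elems (λ x → 𝟙 (allTrivialAt? x)) ≡ 1#
  ∑𝟙[AllTrivialAt]≡1 = *-cancelˡ q-1 q-1≢0 (begin
    q-1 * ∑ elems (λ x → 𝟙 (allTrivialAt? x))   ≡⟨ *-distribˡ-∑ elems q-1 _ ⟩
    ∑ elems (λ x → q-1 * 𝟙 (allTrivialAt? x))   ≡⟨ ∑-cong elems (λ x → sym (∑ψ≡[q-1]𝟙[AllTrivialAt] x)) ⟩
    ∑ elems ∑ψ                                  ≡⟨ ∑∑ψ≡q-1 ⟩
    q-1                                         ≡⟨ sym (*-identityʳ q-1) ⟩
    q-1 * 1#                                    ∎)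

  module _ (y : Fq) (y≢1 : y ≢ 1ᶠ) (all1 : AllTrivialAt y) where
    private
      Other : Fq → Set
      Other x = AllTrivialAt x × x ≢ 1ᶠ × x ≢ y

      other? : ∀ x → Dec (Other x)
      other? x with allTrivialAt? x | x ≟ᶠ 1ᶠ | x ≟ᶠ y
      ... | yes h  | no x≢1 | no x≢y = yes (h , x≢1 , x≢y)
      ... | no ¬h  | _      | _      = no (λ o → ¬h (proj₁ o))
      ... | yes _  | yes x≡1 | _     = no (λ o → proj₁ (proj₂ o) x≡1)
      ... | yes _  | no _   | yes x≡y = no (λ o → proj₂ (proj₂ o) x≡y)

    𝟙[AllTrivialAt]-split : ∀ x → 𝟙 (x ≟ᶠ 1ᶠ) + 𝟙 (x ≟ᶠ y) + 𝟙 (other? x) ≡ 𝟙 (allTrivialAt? x)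
    𝟙[AllTrivialAt]-split x with allTrivialAt? x | x ≟ᶠ 1ᶠ | x ≟ᶠ y
    ... | yes h | no x≢1 | no x≢y = trans (cong (_+ 1#) (+-identityˡ 0#)) (+-identityˡ 1#)
    ... | no ¬h | yes refl | _    = ⊥-elim (¬h allTrivialAt-1)
    ... | no ¬h | no _  | yes refl = ⊥-elim (¬h all1)
    ... | no ¬h | no _  | no _    = trans (+-identityʳ _) (+-identityˡ 0#)
    ... | yes h | yes refl | yes refl = ⊥-elim (y≢1 refl)
    ... | yes h | yes _ | no _    = trans (+-identityʳ _) (+-identityʳ 1#)
    ... | yes h | no _  | yes _   = trans (+-identityʳ _) (+-identityˡ 1#)

    -- Counting: both 1 and y would contribute to a sum that equals 1, contradicting characteristic zero.
    ¬AllTrivialAt-≢1 : ⊥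
    ¬AllTrivialAt-≢1 with ∑-fromℕ elems (λ x → 𝟙 (other? x)) (λ x → 𝟙-fromℕ (other? x))
    ... | m , ∑other≡m = CharZeroField.charZero K m (x+y≡x⇒y≡0 1# _ (begin
      1# + (1# + fromℕ m)                 ≡⟨ sym (+-assoc _ _ _) ⟩
      1# + 1# + fromℕ m                   ≡⟨ cong₂ (λ u v → u + v + fromℕ m)
                                               (sym (∑-𝟙-≡ 1ᶠ (λ _ → 1#))) (sym (∑-𝟙-≡ y (λ _ → 1#))) ⟩
      ∑ elems (λ x → 𝟙 (x ≟ᶠ 1ᶠ) * 1#) + ∑ elems (λ x → 𝟙 (x ≟ᶠ y) * 1#) + fromℕ m
                                          ≡⟨ cong₂ (λ u v → u + v + fromℕ m) (∑-cong elems (λ x → *-identityʳ _)) (∑-cong elems (λ x → *-identityʳ _)) ⟩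
      ∑ elems (λ x → 𝟙 (x ≟ᶠ 1ᶠ)) + ∑ elems (λ x → 𝟙 (x ≟ᶠ y)) + fromℕ m
                                          ≡⟨ cong₂ _+_ (sym (∑-distrib-+ elems _ _)) (sym ∑other≡m) ⟩
      ∑ elems (λ x → 𝟙 (x ≟ᶠ 1ᶠ) + 𝟙 (x ≟ᶠ y)) + ∑ elems (λ x → 𝟙 (other? x))
                                          ≡⟨ sym (∑-distrib-+ elems _ _) ⟩
      ∑ elems (λ x → 𝟙 (x ≟ᶠ 1ᶠ) + 𝟙 (x ≟ᶠ y) + 𝟙 (other? x))
                                          ≡⟨ ∑-cong elems 𝟙[AllTrivialAt]-split ⟩
      ∑ elems (λ x → 𝟙 (allTrivialAt? x)) ≡⟨ ∑𝟙[AllTrivialAt]≡1 ⟩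
      1#                                  ∎))

  ∑ψ≡[q-1]𝟙[≡1] : ∀ y → ∑ψ y ≡ q-1 * 𝟙 (y ≟ᶠ 1ᶠ)
  ∑ψ≡[q-1]𝟙[≡1] y with y ≟ᶠ 1ᶠ | allTrivialAt? y | ∑ψ≡[q-1]𝟙[AllTrivialAt] y
  ... | yes refl | _        | _ = trans (∑-cong-∈ chars (λ ψ ψ∈ → IsMultChar.at1 (members ψ∈))) (trans ∑-chars-one (sym (*-identityʳ q-1)))
  ... | no y≢1   | yes all1 | _ = ⊥-elim (¬AllTrivialAt-≢1 y y≢1 all1)
  ... | no _     | no _     | e = e

module GaussSums (F : FiniteField) (K : CharZeroField) (θ : Fun F K) (θ-char : IsNontrivAddChar F K θ)
                 (θ0≡1 : θ (FiniteField.0# F) ≡ CharZeroField.1# K) where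
  open Characters F K public
  open IsNontrivAddChar θ-char
  open ≡-Reasoning

  ∑θ≡0 : ∑ elems θ ≡ 0#
  ∑θ≡0 with nontriv
  ... | b , θb≢1 = c*x≡x⇒x≡0 (θ b) _ θb≢1
        (trans (*-distribˡ-∑ elems (θ b) θ) (trans (∑-cong elems (λ x → sym (add b x))) (∑-translate b θ)))

  ∑θ[c*x]≡q𝟙[c≡0] : ∀ c → ∑ elems (λ x → θ (c *ᶠ x)) ≡ fromℕ q * 𝟙 (c ≟ᶠ 0ᶠ)
  ∑θ[c*x]≡q𝟙[c≡0] c with c ≟ᶠ 0ᶠ
  ... | yes refl = trans (∑-cong elems (λ x → trans (cong θ (𝔽.zeroˡ x)) θ0≡1)) (trans (∑-one elems) (sym (*-identityʳ _)))
  ... | no c≢0   = trans (∑-dilate c c≢0 θ) (trans ∑θ≡0 (sym (zeroʳ _)))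

  g : Fn → Carrier
  g χ = ∑ elems (λ x → χ x * θ x)

  J : Fn → Fn → Carrier
  J χ ψ = ∑ elems (λ s → χ s * ψ (1ᶠ- s))

  g-cong : ∀ {φ ψ} → φ ≈ ψ → g φ ≡ g ψ
  g-cong φ≈ψ = ∑-cong elems (λ x → cong (_* θ x) (φ≈ψ x))

  gε′≡-1 : g ε′ + 1# ≡ 0#
  gε′≡-1 = begin
    g ε′ + 1#                                        ≡⟨ cong (g ε′ +_) (sym (trans (∑-𝟙-≡ 0ᶠ θ) θ0≡1)) ⟩
    g ε′ + ∑ elems (λ x → 𝟙 (x ≟ᶠ 0ᶠ) * θ x)         ≡⟨ sym (∑-distrib-+ elems _ _) ⟩
    ∑ elems (λ x → ε′ x * θ x + 𝟙 (x ≟ᶠ 0ᶠ) * θ x)   ≡⟨ ∑-cong elems (λ x → trans (sym (distribʳ _ _ _))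
                                                          (trans (cong (_* θ x) (ε′+𝟙[≡0]≡1 x)) (*-identityˡ _))) ⟩
    ∑ elems θ                                        ≡⟨ ∑θ≡0 ⟩
    0#                                               ∎

  module _ {χ ψ : Fn} (χ-char : IsMultChar F K χ) (ψ-char : IsMultChar F K ψ) where
    private
      χψ-char = ∙-char χ-char ψ-char
      c = ψ -1ᶠ * q-1 * δ F K (χ ∙ ψ)

    ∑χ[a]ψ[b-a] : ∀ b → ∑ elems (λ a → χ a * ψ (-ᶠ a +ᶠ b)) ≡ (χ ∙ ψ) b * J χ ψ + 𝟙 (b ≟ᶠ 0ᶠ) * c
    ∑χ[a]ψ[b-a] b with b ≟ᶠ 0ᶠ
    ... | yes refl = begin
      ∑ elems (λ a → χ a * ψ (-ᶠ a +ᶠ 0ᶠ))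
        ≡⟨ ∑-cong elems (λ a → trans (cong (λ z → χ a * ψ z) (trans (𝔽.+-identityʳ _) (sym (𝔽.-1*x≈-x a))))
                              (trans (cong (χ a *_) (IsMultChar.mult ψ-char _ _))
                               (solve 3 (λ p r s → (p :* (r :* s)) := (r :* (p :* s))) refl (χ a) (ψ -1ᶠ) (ψ a)))) ⟩
      ∑ elems (λ a → ψ -1ᶠ * (χ ∙ ψ) a)   ≡⟨ sym (*-distribˡ-∑ elems _ _) ⟩
      ψ -1ᶠ * ∑ elems (χ ∙ ψ)             ≡⟨ cong (ψ -1ᶠ *_) (∑χ≡[q-1]δ χψ-char) ⟩
      ψ -1ᶠ * (q-1 * δ F K (χ ∙ ψ))       ≡⟨ sym (*-assoc _ _ _) ⟩
      c                                   ≡⟨ sym (trans (cong₂ _+_ (trans (cong (_* J χ ψ) (IsMultChar.at0 χψ-char)) (zeroˡ _))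
                                                                   (*-identityˡ c)) (+-identityˡ c)) ⟩
      (χ ∙ ψ) 0ᶠ * J χ ψ + 1# * c         ∎
    ... | no b≢0 = begin
      ∑ elems (λ a → χ a * ψ (-ᶠ a +ᶠ b))                 ≡⟨ sym (∑-dilate b b≢0 _) ⟩
      ∑ elems (λ a → χ (b *ᶠ a) * ψ (-ᶠ (b *ᶠ a) +ᶠ b))   ≡⟨ ∑-cong elems (λ a → cong₂ _*_ (IsMultChar.mult χ-char b a)
                                                              (trans (cong ψ (factor a)) (IsMultChar.mult ψ-char b _))) ⟩
      ∑ elems (λ a → χ b * χ a * (ψ b * ψ (1ᶠ- a)))       ≡⟨ ∑-cong elems (λ a → solve 4 (λ p r s t → (p :* r :* (s :* t)) := (p :* s :* (r :* t))) refl
                                                              (χ b) (χ a) (ψ b) (ψ (1ᶠ- a))) ⟩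
      ∑ elems (λ a → (χ ∙ ψ) b * (χ a * ψ (1ᶠ- a)))       ≡⟨ sym (*-distribˡ-∑ elems _ _) ⟩
      (χ ∙ ψ) b * J χ ψ                                   ≡⟨ sym (trans (cong ((χ ∙ ψ) b * J χ ψ +_) (zeroˡ c)) (+-identityʳ _)) ⟩
      (χ ∙ ψ) b * J χ ψ + 0# * c                          ∎
      where
      factor : ∀ a → -ᶠ (b *ᶠ a) +ᶠ b ≡ b *ᶠ (1ᶠ- a)
      factor a = sym (trans (𝔽.distribˡ b 1ᶠ (-ᶠ a))
                   (trans (cong₂ _+ᶠ_ (𝔽.*-identityʳ b) (sym (𝔽.-‿distribʳ-* b a))) (𝔽.+-comm _ _)))

    g*g≡J*g : g χ * g ψ ≡ J χ ψ * g (χ ∙ ψ) + c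
    g*g≡J*g = begin
      g χ * g ψ
        ≡⟨ trans (*-distribʳ-∑ elems (g ψ) _) (∑-cong elems (λ a → *-distribˡ-∑ elems (χ a * θ a) _)) ⟩
      ∑ elems (λ a → ∑ elems (λ b → χ a * θ a * (ψ b * θ b)))
        ≡⟨ ∑-cong elems (λ a → ∑-cong elems (λ b → trans
             (solve 4 (λ p r s t → (p :* r :* (s :* t)) := (p :* s :* (r :* t))) refl (χ a) (θ a) (ψ b) (θ b))
             (cong (χ a * ψ b *_) (sym (add a b))))) ⟩
      ∑ elems (λ a → ∑ elems (λ b → χ a * ψ b * θ (a +ᶠ b)))
        ≡⟨ ∑-cong elems (λ a → sym (∑-translate (-ᶠ a) (λ b → χ a * ψ b * θ (a +ᶠ b)))) ⟩
      ∑ elems (λ a → ∑ elems (λ b → χ a * ψ (-ᶠ a +ᶠ b) * θ (a +ᶠ (-ᶠ a +ᶠ b))))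
        ≡⟨ ∑-cong elems (λ a → ∑-cong elems (λ b → cong (λ z → χ a * ψ (-ᶠ a +ᶠ b) * θ z)
             (trans (sym (𝔽.+-assoc _ _ _)) (trans (cong (_+ᶠ b) (𝔽.-‿inverseʳ a)) (𝔽.+-identityˡ b))))) ⟩
      ∑ elems (λ a → ∑ elems (λ b → χ a * ψ (-ᶠ a +ᶠ b) * θ b))
        ≡⟨ ∑-comm elems elems _ ⟩
      ∑ elems (λ b → ∑ elems (λ a → χ a * ψ (-ᶠ a +ᶠ b) * θ b))
        ≡⟨ ∑-cong elems (λ b → trans (sym (*-distribʳ-∑ elems (θ b) _)) (cong (_* θ b) (∑χ[a]ψ[b-a] b))) ⟩
      ∑ elems (λ b → ((χ ∙ ψ) b * J χ ψ + 𝟙 (b ≟ᶠ 0ᶠ) * c) * θ b)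
        ≡⟨ ∑-cong elems (λ b → trans (distribʳ _ _ _) (cong₂ _+_
              (solve 3 (λ p r s → (p :* r :* s) := (r :* (p :* s))) refl ((χ ∙ ψ) b) (J χ ψ) (θ b))
              (solve 3 (λ p r s → (p :* r :* s) := (p :* (s :* r))) refl (𝟙 (b ≟ᶠ 0ᶠ)) c (θ b)))) ⟩
      ∑ elems (λ b → J χ ψ * ((χ ∙ ψ) b * θ b) + 𝟙 (b ≟ᶠ 0ᶠ) * (θ b * c))
        ≡⟨ ∑-distrib-+ elems _ _ ⟩
      ∑ elems (λ b → J χ ψ * ((χ ∙ ψ) b * θ b)) + ∑ elems (λ b → 𝟙 (b ≟ᶠ 0ᶠ) * (θ b * c))
        ≡⟨ cong₂ _+_ (sym (*-distribˡ-∑ elems (J χ ψ) _)) (∑-𝟙-≡ 0ᶠ (λ b → θ b * c)) ⟩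
      J χ ψ * g (χ ∙ ψ) + θ 0ᶠ * c
        ≡⟨ cong (J χ ψ * g (χ ∙ ψ) +_) (trans (cong (_* c) θ0≡1) (*-identityˡ c)) ⟩
      J χ ψ * g (χ ∙ ψ) + c ∎

    g*g≡J*g-≈ : ∀ {φ} → χ ∙ ψ ≈ φ → g χ * g ψ ≡ J χ ψ * g φ + ψ -1ᶠ * q-1 * δ F K φ
    g*g≡J*g-≈ e = trans g*g≡J*g (cong₂ (λ u v → J χ ψ * u + ψ -1ᶠ * q-1 * v) (g-cong e) (δ-cong e))

  module _ {χ : Fn} (χ-char : IsMultChar F K χ) where
    private
      X : Fq → Carrier
      X b = ∑ elems (λ a → χ a * θ (b *ᶠ (1ᶠ +ᶠ a)))

    χ̄θgχ≡X : ∀ b → b ≢ 0ᶠ → inv′ χ b * θ b * g χ ≡ X b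
    χ̄θgχ≡X b b≢0 = begin
      inv′ χ b * θ b * g χ
        ≡⟨ cong (inv′ χ b * θ b *_) (sym (∑-dilate b b≢0 _)) ⟩
      inv′ χ b * θ b * ∑ elems (λ a → χ (b *ᶠ a) * θ (b *ᶠ a))
        ≡⟨ *-distribˡ-∑ elems _ _ ⟩
      ∑ elems (λ a → inv′ χ b * θ b * (χ (b *ᶠ a) * θ (b *ᶠ a)))
        ≡⟨ ∑-cong elems (λ a → trans (cong (λ z → inv′ χ b * θ b * (z * θ (b *ᶠ a))) (IsMultChar.mult χ-char b a))
             (solve 5 (λ u v w x y → (u :* v :* (w :* x :* y)) := (u :* w :* (x :* (v :* y)))) refl
                (inv′ χ b) (θ b) (χ b) (χ a) (θ (b *ᶠ a)))) ⟩
      ∑ elems (λ a → χ b ⁻¹ * χ b * (χ a * (θ b * θ (b *ᶠ a))))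
        ≡⟨ ∑-cong elems (λ a → trans (cong (_* (χ a * (θ b * θ (b *ᶠ a)))) (inverseˡ (χ b) (χ≢0 χ-char b≢0)))
             (trans (*-identityˡ _) (cong (χ a *_) (trans (sym (add _ _))
               (cong θ (trans (cong (_+ᶠ b *ᶠ a) (sym (𝔽.*-identityʳ b))) (sym (𝔽.distribˡ b 1ᶠ a)))))))) ⟩
      X b ∎

    χ̄θgχ+𝟙X≡X : ∀ b → inv′ χ b * θ b * g χ + 𝟙 (b ≟ᶠ 0ᶠ) * X b ≡ X b
    χ̄θgχ+𝟙X≡X b with b ≟ᶠ 0ᶠ
    ... | yes refl = trans (cong₂ _+_ χ̄θgχ≡0 (*-identityˡ _)) (+-identityˡ _)
      where
      χ̄θgχ≡0 : inv′ χ 0ᶠ * θ 0ᶠ * g χ ≡ 0#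
      χ̄θgχ≡0 = trans (cong (λ z → z * θ 0ᶠ * g χ) (IsMultChar.at0 (inv-char χ-char)))
                 (trans (cong (_* g χ) (zeroˡ _)) (zeroˡ _))
    ... | no b≢0 = trans (cong₂ _+_ (χ̄θgχ≡X b b≢0) (zeroˡ _)) (+-identityʳ _)

    gχ*gχ̄+[q-1]δ≡χ[-1]q : g χ * g (inv′ χ) + q-1 * δ F K χ ≡ χ -1ᶠ * fromℕ q
    gχ*gχ̄+[q-1]δ≡χ[-1]q = begin
      g χ * g (inv′ χ) + q-1 * δ F K χ
        ≡⟨ cong₂ _+_ (trans (*-comm _ _) (*-distribʳ-∑ elems (g χ) _)) (sym (∑χ≡[q-1]δ χ-char)) ⟩
      ∑ elems (λ b → inv′ χ b * θ b * g χ) + ∑ elems χ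
        ≡⟨ cong (∑ elems (λ b → inv′ χ b * θ b * g χ) +_) (sym (trans (∑-𝟙-≡ 0ᶠ X) X0≡∑χ)) ⟩
      ∑ elems (λ b → inv′ χ b * θ b * g χ) + ∑ elems (λ b → 𝟙 (b ≟ᶠ 0ᶠ) * X b)
        ≡⟨ trans (sym (∑-distrib-+ elems _ _)) (∑-cong elems χ̄θgχ+𝟙X≡X) ⟩
      ∑ elems X
        ≡⟨ trans (∑-comm elems elems _) (∑-cong elems (λ a → sym (*-distribˡ-∑ elems (χ a) _))) ⟩
      ∑ elems (λ a → χ a * ∑ elems (λ b → θ (b *ᶠ (1ᶠ +ᶠ a))))
        ≡⟨ ∑-cong elems (λ a → cong (χ a *_) (trans (∑-cong elems (λ b → cong θ (𝔽.*-comm b _))) (∑θ[c*x]≡q𝟙[c≡0] (1ᶠ +ᶠ a)))) ⟩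
      ∑ elems (λ a → χ a * (fromℕ q * 𝟙 ((1ᶠ +ᶠ a) ≟ᶠ 0ᶠ)))
        ≡⟨ ∑-cong elems (λ a → trans (solve 3 (λ p r s → (p :* (r :* s)) := (s :* (r :* p))) refl (χ a) (fromℕ q) _)
             (cong (_* (fromℕ q * χ a)) (𝟙-⇔ ((1ᶠ +ᶠ a) ≟ᶠ 0ᶠ) (a ≟ᶠ -1ᶠ) 1+a≡0⇒a≡-1 a≡-1⇒1+a≡0))) ⟩
      ∑ elems (λ a → 𝟙 (a ≟ᶠ -1ᶠ) * (fromℕ q * χ a))
        ≡⟨ trans (∑-𝟙-≡ -1ᶠ _) (*-comm _ _) ⟩
      χ -1ᶠ * fromℕ q ∎
      where
      X0≡∑χ : X 0ᶠ ≡ ∑ elems χ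
      X0≡∑χ = ∑-cong elems (λ a → trans (cong (λ z → χ a * θ z) (𝔽.zeroˡ _)) (trans (cong (χ a *_) θ0≡1) (*-identityʳ _)))
      1+a≡0⇒a≡-1 : ∀ {a} → 1ᶠ +ᶠ a ≡ 0ᶠ → a ≡ -1ᶠ
      1+a≡0⇒a≡-1 {a} = 𝔽.-‿inverseʳ-unique 1ᶠ a
      a≡-1⇒1+a≡0 : ∀ {a} → a ≡ -1ᶠ → 1ᶠ +ᶠ a ≡ 0ᶠ
      a≡-1⇒1+a≡0 refl = 𝔽.-‿inverseʳ 1ᶠ

  module _ {χ : Fn} (χ-char : IsMultChar F K χ) where
    private
      [q-1]δ≡χ[-1]q : g χ ≡ 0# → q-1 * δ F K χ ≡ χ -1ᶠ * fromℕ q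
      [q-1]δ≡χ[-1]q gχ≡0 = trans (sym (trans (cong (λ z → z * g (inv′ χ) + q-1 * δ F K χ) gχ≡0)
                                 (trans (cong (_+ q-1 * δ F K χ) (zeroˡ _)) (+-identityˡ _))))
                            (gχ*gχ̄+[q-1]δ≡χ[-1]q χ-char)

    g≢0 : g χ ≢ 0#
    g≢0 gχ≡0 with χ ≈? ε′
    ... | yes χ≈ε = 1≢0 (x+y≡x⇒y≡0 q-1 1# (trans q-1+1≡q (sym (begin
      q-1                ≡⟨ sym (*-identityʳ q-1) ⟩
      q-1 * 1#           ≡⟨ cong (q-1 *_) (sym (trans (δ≡𝟙[≈ε] χ) (𝟙-yes (χ ≈? ε′) χ≈ε))) ⟩
      q-1 * δ F K χ      ≡⟨ [q-1]δ≡χ[-1]q gχ≡0 ⟩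
      χ -1ᶠ * fromℕ q    ≡⟨ cong (_* fromℕ q) (trans (χ≈ε -1ᶠ) (ε′-nonzero 𝔽.-1≢0)) ⟩
      1# * fromℕ q       ≡⟨ *-identityˡ _ ⟩
      fromℕ q            ∎))))
    ... | no χ≉ε = x*y≢0 (χ≢0 χ-char 𝔽.-1≢0) q≢0 (begin
      χ -1ᶠ * fromℕ q    ≡⟨ sym ([q-1]δ≡χ[-1]q gχ≡0) ⟩
      q-1 * δ F K χ      ≡⟨ cong (q-1 *_) (trans (δ≡𝟙[≈ε] χ) (𝟙-no (χ ≈? ε′) χ≉ε)) ⟩
      q-1 * 0#           ≡⟨ zeroʳ q-1 ⟩
      0#                 ∎)

module JacobiSums (F : FiniteField) (K : CharZeroField) (θ : Fun F K) (θ-char : IsNontrivAddChar F K θ)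
                  (θ0≡1 : θ (FiniteField.0# F) ≡ CharZeroField.1# K)
                  (chars : List (Fun F K)) (cg : IsCharGroup F K chars) where
  open GaussSums F K θ θ-char θ0≡1 public
  open CharacterGroup F K chars cg using (∑ψ≡[q-1]𝟙[≡1]; ∑-chars-one)
  open IsCharGroup cg using (members)
  open 𝔽 using () renaming (odds to oddsᶠ)
  open ≡-Reasoning

  ∑-chars-∑ψ : (c : Fq → Carrier) (w : Fq → Fq) →
    ∑ chars (λ ψ → ∑ elems (λ s → c s * ψ (w s))) ≡ ∑ elems (λ s → c s * (q-1 * 𝟙 (w s ≟ᶠ 1ᶠ)))
  ∑-chars-∑ψ c w = trans (∑-comm chars elems _)
    (∑-cong elems (λ s → trans (sym (*-distribˡ-∑ chars (c s) _)) (cong (c s *_) (∑ψ≡[q-1]𝟙[≡1] (w s)))))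

  ∑-chars-∑∑ψ : (c : Fq → Fq → Carrier) (w : Fq → Fq → Fq) →
    ∑ chars (λ ψ → ∑ elems (λ s → ∑ elems (λ t → c s t * ψ (w s t)))) ≡
    ∑ elems (λ s → ∑ elems (λ t → c s t * (q-1 * 𝟙 (w s t ≟ᶠ 1ᶠ))))
  ∑-chars-∑∑ψ c w = trans (∑-comm chars elems _) (∑-cong elems (λ s → ∑-chars-∑ψ (c s) (w s)))

  ψ[odds/-1] : ∀ {ψ} → IsMultChar F K ψ → ∀ s → ψ s * ψ (1ᶠ- s) ⁻¹ * ψ -1ᶠ ⁻¹ ≡ ψ (oddsᶠ s *ᶠ -1ᶠ ⁻¹ᶠ)
  ψ[odds/-1] {ψ} ψ-char s = trans (cong (_* ψ -1ᶠ ⁻¹) (χ-/ ψ-char s (1ᶠ- s))) (χ-/ ψ-char (oddsᶠ s) -1ᶠ)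

  ∑-𝟙[odds/-1≡1]≡0 : (c : Fq → Carrier) → ∑ elems (λ s → c s * (q-1 * 𝟙 ((oddsᶠ s *ᶠ -1ᶠ ⁻¹ᶠ) ≟ᶠ 1ᶠ))) ≡ 0#
  ∑-𝟙[odds/-1≡1]≡0 c = ∑-zero elems (λ s →
    trans (cong (λ z → c s * (q-1 * z)) (𝟙-no ((oddsᶠ s *ᶠ -1ᶠ ⁻¹ᶠ) ≟ᶠ 1ᶠ) (𝔽.odds/-1≢1 s)))
          (trans (cong (c s *_) (zeroʳ q-1)) (zeroʳ _)))

  -- Expanding J₁ ψ * J₂ ψ (resp. with a₁, a₂) as double sums, the ψ-dependence is ψ(odds s · odds t)
  -- (resp. ψ(odds s / -1)), so summing over ψ leaves only the solutions t = 1 - s (resp. none).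
  module _ {A₀ A B χ : Fn} (A₀-char : IsMultChar F K A₀) (A-char : IsMultChar F K A)
           (B-char : IsMultChar F K B) (χ-char : IsMultChar F K χ) where
    J₁ J₂ a₁ a₂ : Fn → Carrier
    J₁ ψ = J (A ∙ ψ) (inv′ ψ ∙ χ)
    J₂ ψ = J (B ∙ ψ) (inv′ A₀ ∙ inv′ ψ ∙ inv′ χ)
    a₁ ψ = (inv′ ψ ∙ χ) -1ᶠ
    a₂ ψ = (inv′ A₀ ∙ inv′ ψ ∙ inv′ χ) -1ᶠ

    private
      c : Fq → Fq → Carrier
      c s t = A s * χ (1ᶠ- s) * (B t * (A₀ (1ᶠ- t) ⁻¹ * χ (1ᶠ- t) ⁻¹))

      J₁J₂-expand : ∀ {ψ} → IsMultChar F K ψ → J₁ ψ * J₂ ψ ≡ ∑ elems (λ s → ∑ elems (λ t → c s t * ψ (oddsᶠ s *ᶠ oddsᶠ t)))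
      J₁J₂-expand {ψ} ψ-char = trans (*-distribʳ-∑ elems _ _) (∑-cong elems (λ s → trans (*-distribˡ-∑ elems _ _) (∑-cong elems (λ t →
        trans (solve 9 (λ As ψs ψ1s χ1s Bt ψt A1t ψ1t χ1t →
                 (As :* ψs :* (ψ1s :* χ1s) :* (Bt :* ψt :* (A1t :* ψ1t :* χ1t)))
                 := (As :* χ1s :* (Bt :* (A1t :* χ1t)) :* (ψs :* ψ1s :* (ψt :* ψ1t)))) refl
                 (A s) (ψ s) (ψ (1ᶠ- s) ⁻¹) (χ (1ᶠ- s)) (B t) (ψ t) (A₀ (1ᶠ- t) ⁻¹) (ψ (1ᶠ- t) ⁻¹) (χ (1ᶠ- t) ⁻¹))
          (cong (c s t *_) (trans (cong₂ _*_ (χ-/ ψ-char s (1ᶠ- s)) (χ-/ ψ-char t (1ᶠ- t))) (sym (IsMultChar.mult ψ-char _ _))))))))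

      c-vanishes : ∀ s → A s * χ (1ᶠ- s) ≡ 0# → ∀ t → c s t ≡ 0#
      c-vanishes s e t = trans (cong (_* (B t * (A₀ (1ᶠ- t) ⁻¹ * χ (1ᶠ- t) ⁻¹))) e) (zeroˡ _)

      ∑-𝟙-c-vanishing : ∀ {s} → A s * χ (1ᶠ- s) ≡ 0# → ∑ elems (λ t → 𝟙 ((oddsᶠ s *ᶠ oddsᶠ t) ≟ᶠ 1ᶠ) * c s t) ≡ c s (1ᶠ- s)
      ∑-𝟙-c-vanishing {s} e = trans (∑-zero elems (λ t → trans (cong (𝟙 ((oddsᶠ s *ᶠ oddsᶠ t) ≟ᶠ 1ᶠ) *_) (c-vanishes s e t)) (zeroʳ _)))
                              (sym (c-vanishes s e (1ᶠ- s)))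

      ∑-𝟙[odds*odds≡1] : ∀ s → ∑ elems (λ t → 𝟙 ((oddsᶠ s *ᶠ oddsᶠ t) ≟ᶠ 1ᶠ) * c s t) ≡ c s (1ᶠ- s)
      ∑-𝟙[odds*odds≡1] s with s ≟ᶠ 0ᶠ | s ≟ᶠ 1ᶠ
      ... | no s≢0 | no s≢1 =
        trans (∑-cong elems (λ t → cong (_* c s t) (𝟙-⇔ ((oddsᶠ s *ᶠ oddsᶠ t) ≟ᶠ 1ᶠ) (t ≟ᶠ (1ᶠ- s))
                  (𝔽.odds-*-odds≡1⇒≡1-s s t s≢0 s≢1) (λ { refl → 𝔽.≡1-s⇒odds-*-odds≡1 s s≢0 s≢1 }))))
              (∑-𝟙-≡ (1ᶠ- s) (c s))
      ... | yes refl | _ = ∑-𝟙-c-vanishing (trans (cong (_* χ (1ᶠ- 0ᶠ)) (IsMultChar.at0 A-char)) (zeroˡ _))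
      ... | no _ | yes refl = ∑-𝟙-c-vanishing (trans (cong (λ z → A 1ᶠ * χ z) (𝔽.-‿inverseʳ 1ᶠ))
                                       (trans (cong (A 1ᶠ *_) (IsMultChar.at0 χ-char)) (zeroʳ _)))

      c[s,1-s] : ∀ s → c s (1ᶠ- s) ≡ (inv′ A₀ ∙ A ∙ inv′ χ) s * (B ∙ χ) (1ᶠ- s)
      c[s,1-s] s = trans (cong (λ z → A s * χ (1ᶠ- s) * (B (1ᶠ- s) * (A₀ z ⁻¹ * χ z ⁻¹))) (𝔽.1-[1-s]≡s s))
        (solve 5 (λ As χ1s B1s A0i χi → (As :* χ1s :* (B1s :* (A0i :* χi))) := (A0i :* As :* χi :* (B1s :* χ1s))) refl
           (A s) (χ (1ᶠ- s)) (B (1ᶠ- s)) (A₀ s ⁻¹) (χ s ⁻¹))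

    ∑J₁J₂≡[q-1]J : ∑ chars (λ ψ → J₁ ψ * J₂ ψ) ≡ q-1 * J (inv′ A₀ ∙ A ∙ inv′ χ) (B ∙ χ)
    ∑J₁J₂≡[q-1]J = begin
      ∑ chars (λ ψ → J₁ ψ * J₂ ψ)
        ≡⟨ ∑-cong-∈ chars (λ ψ ψ∈ → J₁J₂-expand (members ψ∈)) ⟩
      ∑ chars (λ ψ → ∑ elems (λ s → ∑ elems (λ t → c s t * ψ (oddsᶠ s *ᶠ oddsᶠ t))))
        ≡⟨ ∑-chars-∑∑ψ c (λ s t → oddsᶠ s *ᶠ oddsᶠ t) ⟩
      ∑ elems (λ s → ∑ elems (λ t → c s t * (q-1 * 𝟙 ((oddsᶠ s *ᶠ oddsᶠ t) ≟ᶠ 1ᶠ))))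
        ≡⟨ ∑-cong elems (λ s → trans (∑-cong elems (λ t → solve 3 (λ x y z → (x :* (y :* z)) := (y :* (z :* x))) refl (c s t) q-1 _))
             (trans (sym (*-distribˡ-∑ elems q-1 _)) (cong (q-1 *_) (trans (∑-𝟙[odds*odds≡1] s) (c[s,1-s] s))))) ⟩
      ∑ elems (λ s → q-1 * ((inv′ A₀ ∙ A ∙ inv′ χ) s * (B ∙ χ) (1ᶠ- s)))
        ≡⟨ sym (*-distribˡ-∑ elems q-1 _) ⟩
      q-1 * J (inv′ A₀ ∙ A ∙ inv′ χ) (B ∙ χ) ∎

    ∑J₁a₂≡0 : ∑ chars (λ ψ → J₁ ψ * a₂ ψ) ≡ 0#
    ∑J₁a₂≡0 = trans (∑-cong-∈ chars (λ ψ ψ∈ → expand (members ψ∈))) (trans (∑-chars-∑ψ c₁ _) (∑-𝟙[odds/-1≡1]≡0 c₁))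
      where
      c₁ : Fq → Carrier
      c₁ s = A s * χ (1ᶠ- s) * (A₀ -1ᶠ ⁻¹ * χ -1ᶠ ⁻¹)
      expand : ∀ {ψ} → IsMultChar F K ψ → J₁ ψ * a₂ ψ ≡ ∑ elems (λ s → c₁ s * ψ (oddsᶠ s *ᶠ -1ᶠ ⁻¹ᶠ))
      expand {ψ} ψ-char = trans (*-distribʳ-∑ elems _ _) (∑-cong elems (λ s → trans
        (solve 7 (λ As ψs ψ1s χ1s A0m ψm χm → (As :* ψs :* (ψ1s :* χ1s) :* (A0m :* ψm :* χm))
                   := (As :* χ1s :* (A0m :* χm) :* (ψs :* ψ1s :* ψm))) refl
           (A s) (ψ s) (ψ (1ᶠ- s) ⁻¹) (χ (1ᶠ- s)) (A₀ -1ᶠ ⁻¹) (ψ -1ᶠ ⁻¹) (χ -1ᶠ ⁻¹))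
        (cong (c₁ s *_) (ψ[odds/-1] ψ-char s))))

    ∑a₁J₂≡0 : ∑ chars (λ ψ → a₁ ψ * J₂ ψ) ≡ 0#
    ∑a₁J₂≡0 = trans (∑-cong-∈ chars (λ ψ ψ∈ → expand (members ψ∈))) (trans (∑-chars-∑ψ c₂ _) (∑-𝟙[odds/-1≡1]≡0 c₂))
      where
      c₂ : Fq → Carrier
      c₂ t = χ -1ᶠ * (B t * (A₀ (1ᶠ- t) ⁻¹ * χ (1ᶠ- t) ⁻¹))
      expand : ∀ {ψ} → IsMultChar F K ψ → a₁ ψ * J₂ ψ ≡ ∑ elems (λ s → c₂ s * ψ (oddsᶠ s *ᶠ -1ᶠ ⁻¹ᶠ))
      expand {ψ} ψ-char = trans (*-distribˡ-∑ elems _ _) (∑-cong elems (λ t → trans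
        (solve 7 (λ ψm χm Bt ψt A1t ψ1t χ1t → (ψm :* χm :* (Bt :* ψt :* (A1t :* ψ1t :* χ1t)))
                   := (χm :* (Bt :* (A1t :* χ1t)) :* (ψt :* ψ1t :* ψm))) refl
           (ψ -1ᶠ ⁻¹) (χ -1ᶠ) (B t) (ψ t) (A₀ (1ᶠ- t) ⁻¹) (ψ (1ᶠ- t) ⁻¹) (χ (1ᶠ- t) ⁻¹))
        (cong (c₂ t *_) (ψ[odds/-1] ψ-char t))))

    ∑a₁a₂≡[q-1]A₀[-1] : ∑ chars (λ ψ → a₁ ψ * a₂ ψ) ≡ q-1 * A₀ -1ᶠ
    ∑a₁a₂≡[q-1]A₀[-1] = begin
      ∑ chars (λ ψ → a₁ ψ * a₂ ψ)     ≡⟨ ∑-cong-∈ chars (λ ψ ψ∈ → a₁a₂≡A₀[-1] (members ψ∈)) ⟩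
      ∑ chars (λ _ → A₀ -1ᶠ * 1#)     ≡⟨ sym (*-distribˡ-∑ chars _ _) ⟩
      A₀ -1ᶠ * ∑ chars (λ _ → 1#)     ≡⟨ cong (A₀ -1ᶠ *_) ∑-chars-one ⟩
      A₀ -1ᶠ * q-1                    ≡⟨ *-comm _ _ ⟩
      q-1 * A₀ -1ᶠ                    ∎
      where
      a₁a₂≡A₀[-1] : ∀ {ψ} → IsMultChar F K ψ → a₁ ψ * a₂ ψ ≡ A₀ -1ᶠ * 1#
      a₁a₂≡A₀[-1] {ψ} ψ-char = begin
        ψ -1ᶠ ⁻¹ * χ -1ᶠ * (A₀ -1ᶠ ⁻¹ * ψ -1ᶠ ⁻¹ * χ -1ᶠ ⁻¹)
          ≡⟨ cong₂ (λ x y → x * χ -1ᶠ * (A₀ -1ᶠ ⁻¹ * x * y)) (χ[-1]⁻¹≡χ[-1] ψ-char) (χ[-1]⁻¹≡χ[-1] χ-char) ⟩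
        ψ -1ᶠ * χ -1ᶠ * (A₀ -1ᶠ ⁻¹ * ψ -1ᶠ * χ -1ᶠ)
          ≡⟨ solve 3 (λ p c a → (p :* c :* (a :* p :* c)) := (a :* (p :* p :* (c :* c)))) refl (ψ -1ᶠ) (χ -1ᶠ) (A₀ -1ᶠ ⁻¹) ⟩
        A₀ -1ᶠ ⁻¹ * (ψ -1ᶠ * ψ -1ᶠ * (χ -1ᶠ * χ -1ᶠ))
          ≡⟨ cong₂ (λ x y → x * (y * (χ -1ᶠ * χ -1ᶠ))) (χ[-1]⁻¹≡χ[-1] A₀-char) (χ[-1]²≡1 ψ-char) ⟩
        A₀ -1ᶠ * (1# * (χ -1ᶠ * χ -1ᶠ))
          ≡⟨ cong (λ z → A₀ -1ᶠ * z) (trans (*-identityˡ _) (χ[-1]²≡1 χ-char)) ⟩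
        A₀ -1ᶠ * 1# ∎

  module _ {A₀ A B χ : Fn} (A₀-char : IsMultChar F K A₀) (A-char : IsMultChar F K A)
           (B-char : IsMultChar F K B) (χ-char : IsMultChar F K χ) where
    private
      Aχ-char = ∙-char A-char χ-char
      Z-char : IsMultChar F K (inv′ A₀ ∙ B ∙ inv′ χ)
      Z-char = ∙-char (∙-char (inv-char A₀-char) B-char) (inv-char χ-char)
      R-char : IsMultChar F K (inv′ A₀ ∙ A ∙ inv′ χ)
      R-char = ∙-char (∙-char (inv-char A₀-char) A-char) (inv-char χ-char)
      j₁ = J₁ A₀-char A-char B-char χ-char
      j₂ = J₂ A₀-char A-char B-char χ-char
      α₁ = a₁ A₀-char A-char B-char χ-char
      α₂ = a₂ A₀-char A-char B-char χ-char

    private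
      μ : Fn
      μ = inv′ A₀ ∙ A ∙ B

      X Z P R G J′ dA dZ dμ e b ab : Carrier
      X  = g (A ∙ χ)
      Z  = g (inv′ A₀ ∙ B ∙ inv′ χ)
      P  = g (B ∙ χ)
      R  = g (inv′ A₀ ∙ A ∙ inv′ χ)
      G  = g μ
      J′ = J (inv′ A₀ ∙ A ∙ inv′ χ) (B ∙ χ)
      dA = δ F K (A ∙ χ)
      dZ = δ F K (inv′ A₀ ∙ B ∙ inv′ χ)
      dμ = δ F K μ
      e  = A₀ -1ᶠ
      b  = (B ∙ χ) -1ᶠ
      ab = (B ∙ A) -1ᶠ

      T : Carrier
      T = ∑ chars (λ ψ → g (A ∙ ψ) * g (B ∙ ψ) * g (inv′ ψ ∙ χ) * g (inv′ A₀ ∙ inv′ ψ ∙ inv′ χ))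

    gAψ*gψ̄χ : ∀ {ψ} → IsMultChar F K ψ → g (A ∙ ψ) * g (inv′ ψ ∙ χ) ≡ j₁ ψ * X + α₁ ψ * q-1 * dA
    gAψ*gψ̄χ {ψ} ψ-char = g*g≡J*g-≈ (∙-char A-char ψ-char) (∙-char (inv-char ψ-char) χ-char) (λ x →
      trans (solve 4 (λ a p pi c → (a :* p :* (pi :* c)) := (p :* pi :* (a :* c))) refl (A x) (ψ x) (ψ x ⁻¹) (χ x))
            (χ*χ⁻¹-cancel ψ-char x _ (λ { refl → trans (cong (_* χ 0ᶠ) (IsMultChar.at0 A-char)) (zeroˡ _) })))

    gBψ*gĀ₀ψ̄χ̄ : ∀ {ψ} → IsMultChar F K ψ → g (B ∙ ψ) * g (inv′ A₀ ∙ inv′ ψ ∙ inv′ χ) ≡ j₂ ψ * Z + α₂ ψ * q-1 * dZ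
    gBψ*gĀ₀ψ̄χ̄ {ψ} ψ-char = g*g≡J*g-≈ (∙-char B-char ψ-char) (∙-char (∙-char (inv-char A₀-char) (inv-char ψ-char)) (inv-char χ-char)) (λ x →
      trans (solve 5 (λ bb p a0 pi c → (bb :* p :* (a0 :* pi :* c)) := (p :* pi :* (a0 :* bb :* c))) refl
               (B x) (ψ x) (A₀ x ⁻¹) (ψ x ⁻¹) (χ x ⁻¹))
            (χ*χ⁻¹-cancel ψ-char x _ (λ { refl → trans (cong (λ w → A₀ 0ᶠ ⁻¹ * w * χ 0ᶠ ⁻¹) (IsMultChar.at0 B-char))
                                                   (trans (cong (_* χ 0ᶠ ⁻¹) (zeroʳ _)) (zeroˡ _)) })))

    R*P≡J′G : R * P ≡ J′ * G + b * q-1 * dμ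
    R*P≡J′G = g*g≡J*g-≈ R-char (∙-char B-char χ-char) (λ x →
      trans (solve 5 (λ a0 a ci bb c → (a0 :* a :* ci :* (bb :* c)) := (c :* ci :* (a0 :* a :* bb))) refl
               (A₀ x ⁻¹) (A x) (χ x ⁻¹) (B x) (χ x))
            (χ*χ⁻¹-cancel χ-char x _ μ0≡0))
      where
      μ0≡0 : ∀ {x} → x ≡ 0ᶠ → μ x ≡ 0#
      μ0≡0 refl = trans (cong (λ w → A₀ 0ᶠ ⁻¹ * w * B 0ᶠ) (IsMultChar.at0 A-char)) (trans (cong (_* B 0ᶠ) (zeroʳ _)) (zeroˡ _))

    T≡[q-1][XZJ′+…] : T ≡ q-1 * (X * Z * J′ + q-1 * q-1 * dA * dZ * e)
    T≡[q-1][XZJ′+…] = begin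
      T ≡⟨ ∑-cong-∈ chars (λ ψ ψ∈ → expand (members ψ∈)) ⟩
      ∑ chars (λ ψ → X * Z * (j₁ ψ * j₂ ψ) + X * (q-1 * dZ) * (j₁ ψ * α₂ ψ) + q-1 * dA * Z * (α₁ ψ * j₂ ψ) + q-1 * dA * (q-1 * dZ) * (α₁ ψ * α₂ ψ))
        ≡⟨ trans (∑-distrib-+ chars _ _) (cong₂ _+_ (trans (∑-distrib-+ chars _ _) (cong₂ _+_ (∑-distrib-+ chars _ _) refl)) refl) ⟩
      ∑ chars (λ ψ → X * Z * (j₁ ψ * j₂ ψ)) + ∑ chars (λ ψ → X * (q-1 * dZ) * (j₁ ψ * α₂ ψ))
        + ∑ chars (λ ψ → q-1 * dA * Z * (α₁ ψ * j₂ ψ)) + ∑ chars (λ ψ → q-1 * dA * (q-1 * dZ) * (α₁ ψ * α₂ ψ))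
        ≡⟨ sym (cong₂ _+_ (cong₂ _+_ (cong₂ _+_ (*-distribˡ-∑ chars _ _) (*-distribˡ-∑ chars _ _)) (*-distribˡ-∑ chars _ _)) (*-distribˡ-∑ chars _ _)) ⟩
      X * Z * ∑ chars (λ ψ → j₁ ψ * j₂ ψ) + X * (q-1 * dZ) * ∑ chars (λ ψ → j₁ ψ * α₂ ψ)
        + q-1 * dA * Z * ∑ chars (λ ψ → α₁ ψ * j₂ ψ) + q-1 * dA * (q-1 * dZ) * ∑ chars (λ ψ → α₁ ψ * α₂ ψ)
        ≡⟨ cong₂ _+_ (cong₂ _+_ (cong₂ _+_ (cong (X * Z *_) (∑J₁J₂≡[q-1]J A₀-char A-char B-char χ-char))
                                             (cong (X * (q-1 * dZ) *_) (∑J₁a₂≡0 A₀-char A-char B-char χ-char)))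
                                (cong (q-1 * dA * Z *_) (∑a₁J₂≡0 A₀-char A-char B-char χ-char)))
                     (cong (q-1 * dA * (q-1 * dZ) *_) (∑a₁a₂≡[q-1]A₀[-1] A₀-char A-char B-char χ-char)) ⟩
      X * Z * (q-1 * J′) + X * (q-1 * dZ) * 0# + q-1 * dA * Z * 0# + q-1 * dA * (q-1 * dZ) * (q-1 * e)
        ≡⟨ solve 7 (λ x z n j da dz e → (x :* z :* (n :* j) :+ x :* (n :* dz) :* con 0 :+ n :* da :* z :* con 0 :+ n :* da :* (n :* dz) :* (n :* e))
                                          := (n :* (x :* z :* j :+ n :* n :* da :* dz :* e))) refl X Z q-1 J′ dA dZ e ⟩
      q-1 * (X * Z * J′ + q-1 * q-1 * dA * dZ * e) ∎
      where
      expand : ∀ {ψ} → IsMultChar F K ψ →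
               g (A ∙ ψ) * g (B ∙ ψ) * g (inv′ ψ ∙ χ) * g (inv′ A₀ ∙ inv′ ψ ∙ inv′ χ) ≡
               X * Z * (j₁ ψ * j₂ ψ) + X * (q-1 * dZ) * (j₁ ψ * α₂ ψ) + q-1 * dA * Z * (α₁ ψ * j₂ ψ) + q-1 * dA * (q-1 * dZ) * (α₁ ψ * α₂ ψ)
      expand {ψ} ψ-char = begin
        g (A ∙ ψ) * g (B ∙ ψ) * g (inv′ ψ ∙ χ) * g (inv′ A₀ ∙ inv′ ψ ∙ inv′ χ)
          ≡⟨ solve 4 (λ a bb c d → (a :* bb :* c :* d) := ((a :* c) :* (bb :* d))) refl _ _ _ _ ⟩
        g (A ∙ ψ) * g (inv′ ψ ∙ χ) * (g (B ∙ ψ) * g (inv′ A₀ ∙ inv′ ψ ∙ inv′ χ))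
          ≡⟨ cong₂ _*_ (gAψ*gψ̄χ ψ-char) (gBψ*gĀ₀ψ̄χ̄ ψ-char) ⟩
        (j₁ ψ * X + α₁ ψ * q-1 * dA) * (j₂ ψ * Z + α₂ ψ * q-1 * dZ)
          ≡⟨ solve 9 (λ j1 x a1 n da j2 z a2 dz → ((j1 :* x :+ a1 :* n :* da) :* (j2 :* z :+ a2 :* n :* dz)) :=
                 (x :* z :* (j1 :* j2) :+ x :* (n :* dz) :* (j1 :* a2) :+ n :* da :* z :* (a1 :* j2) :+ n :* da :* (n :* dz) :* (a1 :* a2)))
                 refl (j₁ ψ) X (α₁ ψ) q-1 dA (j₂ ψ) Z (α₂ ψ) dZ ⟩
        X * Z * (j₁ ψ * j₂ ψ) + X * (q-1 * dZ) * (j₁ ψ * α₂ ψ) + q-1 * dA * Z * (α₁ ψ * j₂ ψ) + q-1 * dA * (q-1 * dZ) * (α₁ ψ * α₂ ψ) ∎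

    μ≈ε′-if : A ∙ χ ≈ ε′ → inv′ A₀ ∙ B ∙ inv′ χ ≈ ε′ → μ ≈ ε′
    μ≈ε′-if Aχ≈ε Z≈ε x = begin
      μ x                                    ≡⟨ sym (χ*χ⁻¹-cancel χ-char x (μ x) μ0≡0) ⟩
      χ x * χ x ⁻¹ * (A₀ x ⁻¹ * A x * B x)   ≡⟨ solve 5 (λ c ci a0 a bb → (c :* ci :* (a0 :* a :* bb)) := ((a :* c) :* (a0 :* bb :* ci))) refl
                                                  (χ x) (χ x ⁻¹) (A₀ x ⁻¹) (A x) (B x) ⟩
      (A ∙ χ) x * (inv′ A₀ ∙ B ∙ inv′ χ) x   ≡⟨ cong₂ _*_ (Aχ≈ε x) (Z≈ε x) ⟩
      ε′ x * ε′ x                            ≡⟨ ε′²≡ε′ x ⟩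
      ε′ x                                   ∎
      where
      μ0≡0 : x ≡ 0ᶠ → μ x ≡ 0#
      μ0≡0 refl = trans (cong (λ w → A₀ 0ᶠ ⁻¹ * w * B 0ᶠ) (IsMultChar.at0 A-char)) (trans (cong (_* B 0ᶠ) (zeroʳ _)) (zeroˡ _))

    μ≈ε′⇒Z≈inv[Aχ] : μ ≈ ε′ → inv′ A₀ ∙ B ∙ inv′ χ ≈ inv′ (A ∙ χ)
    μ≈ε′⇒Z≈inv[Aχ] μ≈ε x with x ≟ᶠ 0ᶠ
    ... | yes refl = trans (IsMultChar.at0 Z-char) (sym (IsMultChar.at0 (inv-char Aχ-char)))
    ... | no x≢0 = begin
      A₀ x ⁻¹ * B x * χ x ⁻¹                      ≡⟨ sym (*-identityˡ _) ⟩
      1# * (A₀ x ⁻¹ * B x * χ x ⁻¹)               ≡⟨ cong (_* (A₀ x ⁻¹ * B x * χ x ⁻¹)) (sym (inverseʳ _ (χ≢0 A-char x≢0))) ⟩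
      A x * A x ⁻¹ * (A₀ x ⁻¹ * B x * χ x ⁻¹)     ≡⟨ solve 5 (λ a ai a0 bb ci → (a :* ai :* (a0 :* bb :* ci)) := ((a0 :* a :* bb) :* (ai :* ci))) refl
                                                       (A x) (A x ⁻¹) (A₀ x ⁻¹) (B x) (χ x ⁻¹) ⟩
      μ x * (A x ⁻¹ * χ x ⁻¹)                     ≡⟨ cong (_* (A x ⁻¹ * χ x ⁻¹)) (trans (μ≈ε x) (ε′-nonzero x≢0)) ⟩
      1# * (A x ⁻¹ * χ x ⁻¹)                      ≡⟨ *-identityˡ _ ⟩
      A x ⁻¹ * χ x ⁻¹                             ≡⟨ sym (⁻¹-distrib-* _ _) ⟩
      inv′ (A ∙ χ) x                              ∎

    private
      δ≡0 : ∀ {φ} → ¬ φ ≈ ε′ → δ F K φ ≡ 0#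
      δ≡0 {φ} φ≉ε = trans (δ≡𝟙[≈ε] φ) (𝟙-no (φ ≈? ε′) φ≉ε)

      δ≡1 : ∀ {φ} → φ ≈ ε′ → δ F K φ ≡ 1#
      δ≡1 {φ} φ≈ε = trans (δ≡𝟙[≈ε] φ) (𝟙-yes (φ ≈? ε′) φ≈ε)

      dA≡0⇒ : dA ≡ 0# → q-1 * q-1 * dA * dZ * e ≡ 0#
      dA≡0⇒ dA≡0 = trans (cong (λ w → q-1 * q-1 * w * dZ * e) dA≡0)
                     (trans (cong (λ w → w * dZ * e) (zeroʳ _)) (trans (cong (_* e) (zeroˡ _)) (zeroˡ _)))

      dZ≡0⇒ : dZ ≡ 0# → q-1 * q-1 * dA * dZ * e ≡ 0#
      dZ≡0⇒ dZ≡0 = trans (cong (λ w → q-1 * q-1 * dA * w * e) dZ≡0) (trans (cong (_* e) (zeroʳ _)) (zeroˡ _))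

      correction : Set
      correction = X * Z * b * q-1 * dμ ≡ G * (q-1 * q-1 * dA * dZ * e) + fromℕ q * q-1 * ab * dμ

      correction-μ≉ε : ¬ μ ≈ ε′ → correction
      correction-μ≉ε μ≉ε = trans (cong (X * Z * b * q-1 *_) (δ≡0 μ≉ε)) (trans (zeroʳ _) (sym (trans
        (cong₂ _+_ (trans (cong (G *_) dd≡0) (zeroʳ G)) (trans (cong (fromℕ q * q-1 * ab *_) (δ≡0 μ≉ε)) (zeroʳ _)))
        (+-identityˡ 0#))))
        where
        dd≡0 : q-1 * q-1 * dA * dZ * e ≡ 0#
        dd≡0 with A ∙ χ ≈? ε′ | inv′ A₀ ∙ B ∙ inv′ χ ≈? ε′
        ... | yes Aχ≈ε | yes Z≈ε = ⊥-elim (μ≉ε (μ≈ε′-if Aχ≈ε Z≈ε))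
        ... | no Aχ≉ε  | _       = dA≡0⇒ (δ≡0 Aχ≉ε)
        ... | yes _    | no Z≉ε  = dZ≡0⇒ (δ≡0 Z≉ε)

      module _ (μ≈ε : μ ≈ ε′) where
        XZ+[q-1]dA≡Aχ[-1]q : X * Z + q-1 * dA ≡ (A ∙ χ) -1ᶠ * fromℕ q
        XZ+[q-1]dA≡Aχ[-1]q = trans (cong (λ w → X * w + q-1 * dA) (g-cong (μ≈ε′⇒Z≈inv[Aχ] μ≈ε)))
                                    (gχ*gχ̄+[q-1]δ≡χ[-1]q Aχ-char)

        correction-Aχ≉ε : ¬ A ∙ χ ≈ ε′ → correction
        correction-Aχ≉ε Aχ≉ε = begin
          X * Z * b * q-1 * dμ                          ≡⟨ cong₂ (λ u v → u * b * q-1 * v) XZ≡Aχ[-1]q (δ≡1 μ≈ε) ⟩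
          (A ∙ χ) -1ᶠ * fromℕ q * b * q-1 * 1#          ≡⟨ solve 5 (λ aχ qq bb n o → (aχ :* qq :* bb :* n :* o) := (qq :* n :* (aχ :* bb) :* o)) refl
                                                             ((A ∙ χ) -1ᶠ) (fromℕ q) b q-1 1# ⟩
          fromℕ q * q-1 * ((A ∙ χ) -1ᶠ * b) * 1#        ≡⟨ cong (λ w → fromℕ q * q-1 * w * 1#) Aχ[-1]b≡ab ⟩
          fromℕ q * q-1 * ab * 1#                       ≡⟨ sym (+-identityˡ _) ⟩
          0# + fromℕ q * q-1 * ab * 1#                  ≡⟨ cong₂ _+_ (sym (trans (cong (G *_) (dA≡0⇒ (δ≡0 Aχ≉ε))) (zeroʳ G)))
                                                                    (cong (fromℕ q * q-1 * ab *_) (sym (δ≡1 μ≈ε))) ⟩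
          G * (q-1 * q-1 * dA * dZ * e) + fromℕ q * q-1 * ab * dμ ∎
          where
          XZ≡Aχ[-1]q : X * Z ≡ (A ∙ χ) -1ᶠ * fromℕ q
          XZ≡Aχ[-1]q = trans (sym (+-identityʳ _))
            (trans (cong (X * Z +_) (sym (trans (cong (q-1 *_) (δ≡0 Aχ≉ε)) (zeroʳ q-1)))) XZ+[q-1]dA≡Aχ[-1]q)
          Aχ[-1]b≡ab : (A ∙ χ) -1ᶠ * b ≡ ab
          Aχ[-1]b≡ab = trans (solve 3 (λ a c bb → (a :* c :* (bb :* c)) := (bb :* a :* (c :* c))) refl (A -1ᶠ) (χ -1ᶠ) (B -1ᶠ))
                         (trans (cong (B -1ᶠ * A -1ᶠ *_) (χ[-1]²≡1 χ-char)) (*-identityʳ _))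

        -- Here μ = ε′ and A χ = ε′, so G = -1, X Z = q - (q-1), and b = e = ab.
        module _ (Aχ≈ε : A ∙ χ ≈ ε′) where
          dA≡1 : dA ≡ 1#
          dA≡1 = δ≡1 Aχ≈ε
          Aχ[-1]≡1 : (A ∙ χ) -1ᶠ ≡ 1#
          Aχ[-1]≡1 = trans (Aχ≈ε -1ᶠ) (ε′-nonzero 𝔽.-1≢0)
          χ[-1]≡A[-1] : χ -1ᶠ ≡ A -1ᶠ
          χ[-1]≡A[-1] = begin
            χ -1ᶠ                     ≡⟨ sym (*-identityˡ _) ⟩
            1# * χ -1ᶠ                ≡⟨ cong (_* χ -1ᶠ) (sym (χ[-1]²≡1 A-char)) ⟩
            A -1ᶠ * A -1ᶠ * χ -1ᶠ     ≡⟨ *-assoc _ _ _ ⟩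
            A -1ᶠ * (A -1ᶠ * χ -1ᶠ)   ≡⟨ cong (A -1ᶠ *_) Aχ[-1]≡1 ⟩
            A -1ᶠ * 1#                ≡⟨ *-identityʳ _ ⟩
            A -1ᶠ                     ∎
          b≡ab : b ≡ ab
          b≡ab = cong (B -1ᶠ *_) χ[-1]≡A[-1]
          e≡ab : e ≡ ab
          e≡ab = begin
            e                                               ≡⟨ sym (*-identityʳ e) ⟩
            e * 1#                                          ≡⟨ cong (e *_) (sym (trans (cong₂ _*_ (χ[-1]²≡1 B-char) (χ[-1]²≡1 A-char)) (*-identityˡ 1#))) ⟩
            e * (B -1ᶠ * B -1ᶠ * (A -1ᶠ * A -1ᶠ))          ≡⟨ solve 3 (λ ee bb a → (ee :* (bb :* bb :* (a :* a))) := ((ee :* a :* bb) :* (bb :* a))) refl e (B -1ᶠ) (A -1ᶠ) ⟩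
            e * A -1ᶠ * B -1ᶠ * ab                          ≡⟨ cong (λ w → w * A -1ᶠ * B -1ᶠ * ab) (sym (χ[-1]⁻¹≡χ[-1] A₀-char)) ⟩
            μ -1ᶠ * ab                                      ≡⟨ cong (_* ab) (trans (μ≈ε -1ᶠ) (ε′-nonzero 𝔽.-1≢0)) ⟩
            1# * ab                                         ≡⟨ *-identityˡ _ ⟩
            ab                                              ∎
          [q-1]²dAdZe≡[q-1]²ab : q-1 * q-1 * dA * dZ * e ≡ q-1 * q-1 * ab
          [q-1]²dAdZe≡[q-1]²ab = trans (cong₂ (λ u v → q-1 * q-1 * u * v * e) dA≡1 (trans (δ-cong (μ≈ε′⇒Z≈inv[Aχ] μ≈ε)) (trans (δ-inv (A ∙ χ)) dA≡1)))
            (trans (cong (q-1 * q-1 * 1# * 1# *_) e≡ab) (cong (_* ab) (trans (*-identityʳ _) (*-identityʳ _))))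
          XZ+[q-1]≡q : X * Z + q-1 ≡ fromℕ q
          XZ+[q-1]≡q = trans (cong (X * Z +_) (sym (trans (cong (q-1 *_) dA≡1) (*-identityʳ q-1))))
            (trans XZ+[q-1]dA≡Aχ[-1]q (trans (cong (_* fromℕ q) Aχ[-1]≡1) (*-identityˡ _)))
          XZ+[q-1]²ab : X * Z * ab * q-1 + q-1 * q-1 * ab ≡ fromℕ q * q-1 * ab
          XZ+[q-1]²ab = trans (solve 3 (λ x n a → (x :* a :* n :+ n :* n :* a) := ((x :+ n) :* n :* a)) refl (X * Z) q-1 ab)
                          (cong (λ w → w * q-1 * ab) XZ+[q-1]≡q)
          G[q-1]²ab≡-[q-1]²ab : G * (q-1 * q-1 * ab) + q-1 * q-1 * ab ≡ 0#
          G[q-1]²ab≡-[q-1]²ab = begin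
            G * (q-1 * q-1 * ab) + q-1 * q-1 * ab        ≡⟨ cong (G * (q-1 * q-1 * ab) +_) (sym (*-identityˡ _)) ⟩
            G * (q-1 * q-1 * ab) + 1# * (q-1 * q-1 * ab) ≡⟨ sym (distribʳ _ _ _) ⟩
            (G + 1#) * (q-1 * q-1 * ab)                  ≡⟨ cong (_* (q-1 * q-1 * ab)) (trans (cong (_+ 1#) (g-cong μ≈ε)) gε′≡-1) ⟩
            0# * (q-1 * q-1 * ab)                        ≡⟨ zeroˡ _ ⟩
            0#                                           ∎

          correction-Aχ≈ε : correction
          correction-Aχ≈ε = begin
            X * Z * b * q-1 * dμ                          ≡⟨ cong₂ (λ u v → X * Z * u * q-1 * v) b≡ab (δ≡1 μ≈ε) ⟩
            X * Z * ab * q-1 * 1#                         ≡⟨ *-identityʳ _ ⟩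
            X * Z * ab * q-1                              ≡⟨ x+c≡d⇒y+c≡0⇒x≡d+y XZ+[q-1]²ab G[q-1]²ab≡-[q-1]²ab ⟩
            fromℕ q * q-1 * ab + G * (q-1 * q-1 * ab)     ≡⟨ +-comm _ _ ⟩
            G * (q-1 * q-1 * ab) + fromℕ q * q-1 * ab     ≡⟨ cong₂ _+_ (cong (G *_) (sym [q-1]²dAdZe≡[q-1]²ab))
                                                                      (trans (sym (*-identityʳ _)) (cong (fromℕ q * q-1 * ab *_) (sym (δ≡1 μ≈ε)))) ⟩
            G * (q-1 * q-1 * dA * dZ * e) + fromℕ q * q-1 * ab * dμ ∎

    XZb[q-1]dμ≡ : correction
    XZb[q-1]dμ≡ with μ ≈? ε′ | A ∙ χ ≈? ε′
    ... | no μ≉ε  | _         = correction-μ≉ε μ≉ε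
    ... | yes μ≈ε | no Aχ≉ε   = correction-Aχ≉ε μ≈ε Aχ≉ε
    ... | yes μ≈ε | yes Aχ≈ε  = correction-Aχ≈ε μ≈ε Aχ≈ε

    XPRZ≡G[T/[q-1]]+[…]δμ : X * P * R * Z ≡ G * (q-1 ⁻¹ * T) + fromℕ q * q-1 * ab * dμ
    XPRZ≡G[T/[q-1]]+[…]δμ = begin
      X * P * R * Z                                          ≡⟨ solve 4 (λ x p r z → (x :* p :* r :* z) := (x :* z :* (r :* p))) refl X P R Z ⟩
      X * Z * (R * P)                                        ≡⟨ cong (X * Z *_) R*P≡J′G ⟩
      X * Z * (J′ * G + b * q-1 * dμ)                        ≡⟨ solve 7 (λ x z j gg bb n d → (x :* z :* (j :* gg :+ bb :* n :* d)) := (gg :* (x :* z :* j) :+ x :* z :* bb :* n :* d)) refl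
                                                                  X Z J′ G b q-1 dμ ⟩
      G * (X * Z * J′) + X * Z * b * q-1 * dμ                ≡⟨ cong (G * (X * Z * J′) +_) XZb[q-1]dμ≡ ⟩
      G * (X * Z * J′) + (G * (q-1 * q-1 * dA * dZ * e) + fromℕ q * q-1 * ab * dμ)
                                                             ≡⟨ solve 4 (λ gg u v w → (gg :* u :+ (gg :* v :+ w)) := (gg :* (u :+ v) :+ w)) refl
                                                                  G (X * Z * J′) (q-1 * q-1 * dA * dZ * e) (fromℕ q * q-1 * ab * dμ) ⟩
      G * (X * Z * J′ + q-1 * q-1 * dA * dZ * e) + fromℕ q * q-1 * ab * dμ
                                                             ≡⟨ cong (λ w → G * w + fromℕ q * q-1 * ab * dμ) (sym T/[q-1]) ⟩
      G * (q-1 ⁻¹ * T) + fromℕ q * q-1 * ab * dμ             ∎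
      where
      T/[q-1] : q-1 ⁻¹ * T ≡ X * Z * J′ + q-1 * q-1 * dA * dZ * e
      T/[q-1] = trans (cong (q-1 ⁻¹ *_) T≡[q-1][XZJ′+…])
        (trans (sym (*-assoc _ _ _)) (trans (cong (_* (X * Z * J′ + q-1 * q-1 * dA * dZ * e)) (inverseˡ q-1 q-1≢0)) (*-identityˡ _)))

module Reduction (F : FiniteField) (K : CharZeroField) (θ : Fun F K) (θ-char : IsNontrivAddChar F K θ)
                 (θ0≡1 : θ (FiniteField.0# F) ≡ CharZeroField.1# K)
                 (chars : List (Fun F K)) (cg : IsCharGroup F K chars)
                 (k : ℕ) (A₀ : Fun F K) (As : Vec (Fun F K) k) (A B : Fun F K)
                 (A₀-char : IsMultChar F K A₀) (A-char : IsMultChar F K A) (B-char : IsMultChar F K B)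
                 (x : FiniteField.Carrier F) where
  open JacobiSums F K θ θ-char θ0≡1 chars cg
  open IsCharGroup cg using (members)
  open WithData F K θ chars using (hypF)
  open ≡-Reasoning

  Bs : Vec Fn k
  Bs = map (λ A′ → A₀ ∙ inv′ A′) As

  upper lower : Fn → Fn → Carrier
  upper χ A′ = g (A′ ∙ χ) / g A′
  lower χ B′ = g (inv′ (B′ ∙ χ)) / g (inv′ B′)

  -- hypF k A₀ As Bs x is (q-1)⁻¹ times the sum of these over χ, definitionally.
  summand : Fn → Carrier
  summand χ = g (A₀ ∙ χ) / g A₀ * (prodV F K As (upper χ) * (prodV F K Bs (lower χ) * (g (inv′ χ) * (χ -1ᶠ ^ suc k * χ x))))

  D : Carrier
  D = g A * g B * g (inv′ A₀ ∙ A) * g (inv′ A₀ ∙ B)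

  Q : Fn → Carrier
  Q χ = g (A ∙ χ) * g (B ∙ χ) * g (inv′ A₀ ∙ A ∙ inv′ χ) * g (inv′ A₀ ∙ B ∙ inv′ χ)

  inv[A₀Ā′]≈Ā₀A′ : ∀ A′ → inv′ (A₀ ∙ inv′ A′) ≈ inv′ A₀ ∙ A′
  inv[A₀Ā′]≈Ā₀A′ A′ y = trans (⁻¹-distrib-* _ _) (cong (A₀ y ⁻¹ *_) (⁻¹-involutive _))

  lower[A₀Ā′]≡ : ∀ A′ χ → lower χ (A₀ ∙ inv′ A′) ≡ g (inv′ A₀ ∙ A′ ∙ inv′ χ) * g (inv′ A₀ ∙ A′) ⁻¹
  lower[A₀Ā′]≡ A′ χ = cong₂ (λ u v → u * v ⁻¹)
    (g-cong (λ y → trans (⁻¹-distrib-* _ _) (cong (_* χ y ⁻¹) (inv[A₀Ā′]≈Ā₀A′ A′ y))))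
    (g-cong (inv[A₀Ā′]≈Ā₀A′ A′))

  summand₊₂≡summand*Q/D : ∀ {χ} → IsMultChar F K χ →
    g (A₀ ∙ χ) / g A₀ * (prodV F K (As ∷ʳ A ∷ʳ B) (upper χ) * (prodV F K (Bs ∷ʳ (A₀ ∙ inv′ A) ∷ʳ (A₀ ∙ inv′ B)) (lower χ)
       * (g (inv′ χ) * (χ -1ᶠ ^ suc (suc (suc k)) * χ x)))) ≡ summand χ * (Q χ * D ⁻¹)
  summand₊₂≡summand*Q/D {χ} χ-char = begin
    base * (prodV F K (As ∷ʳ A ∷ʳ B) (upper χ) * (prodV F K (Bs ∷ʳ (A₀ ∙ inv′ A) ∷ʳ (A₀ ∙ inv′ B)) (lower χ) * (gi * (s * (s * S) * xc))))
      ≡⟨ cong₂ (λ u v → base * (u * (v * (gi * (s * (s * S) * xc)))))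
           (trans (prodV-∷ʳ (As ∷ʳ A) B (upper χ)) (cong (_* upper χ B) (prodV-∷ʳ As A (upper χ))))
           (trans (prodV-∷ʳ (Bs ∷ʳ (A₀ ∙ inv′ A)) (A₀ ∙ inv′ B) (lower χ)) (cong (_* lower χ (A₀ ∙ inv′ B)) (prodV-∷ʳ Bs (A₀ ∙ inv′ A) (lower χ)))) ⟩
    base * (pa * ua * ub * (pb * la * lb * (gi * (s * (s * S) * xc))))
      ≡⟨ solve 11 (λ ba pa r1 r2 pb b1 b2 gi s S xc →
            (ba :* (pa :* r1 :* r2 :* (pb :* b1 :* b2 :* (gi :* (s :* (s :* S) :* xc)))))
            := ((ba :* (pa :* (pb :* (gi :* (S :* xc))))) :* ((r1 :* r2 :* b1 :* b2) :* (s :* s)))) refl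
            base pa ua ub pb la lb gi s S xc ⟩
    summand χ * (ua * ub * la * lb * (s * s))
      ≡⟨ cong (λ w → summand χ * (ua * ub * la * lb * w)) (χ[-1]²≡1 χ-char) ⟩
    summand χ * (ua * ub * la * lb * 1#)
      ≡⟨ cong (summand χ *_) (trans (*-identityʳ _) ratios≡Q/D) ⟩
    summand χ * (Q χ * D ⁻¹) ∎
    where
    base = g (A₀ ∙ χ) / g A₀
    pa = prodV F K As (upper χ)
    pb = prodV F K Bs (lower χ)
    ua = upper χ A
    ub = upper χ B
    la = lower χ (A₀ ∙ inv′ A)
    lb = lower χ (A₀ ∙ inv′ B)
    gi = g (inv′ χ)
    s = χ -1ᶠ
    S = s ^ suc k
    xc = χ x
    ratios≡Q/D : ua * ub * la * lb ≡ Q χ * D ⁻¹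
    ratios≡Q/D = begin
      g (A ∙ χ) * g A ⁻¹ * (g (B ∙ χ) * g B ⁻¹) * la * lb
        ≡⟨ cong₂ (λ u v → g (A ∙ χ) * g A ⁻¹ * (g (B ∙ χ) * g B ⁻¹) * u * v) (lower[A₀Ā′]≡ A χ) (lower[A₀Ā′]≡ B χ) ⟩
      g (A ∙ χ) * g A ⁻¹ * (g (B ∙ χ) * g B ⁻¹) * (g (inv′ A₀ ∙ A ∙ inv′ χ) * g (inv′ A₀ ∙ A) ⁻¹)
        * (g (inv′ A₀ ∙ B ∙ inv′ χ) * g (inv′ A₀ ∙ B) ⁻¹)
        ≡⟨ solve 8 (λ x a p b r c z d → (x :* a :* (p :* b) :* (r :* c) :* (z :* d)) := ((x :* p :* r :* z) :* (a :* b :* c :* d))) refl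
             (g (A ∙ χ)) (g A ⁻¹) (g (B ∙ χ)) (g B ⁻¹) (g (inv′ A₀ ∙ A ∙ inv′ χ)) (g (inv′ A₀ ∙ A) ⁻¹) (g (inv′ A₀ ∙ B ∙ inv′ χ)) (g (inv′ A₀ ∙ B) ⁻¹) ⟩
      Q χ * (g A ⁻¹ * g B ⁻¹ * g (inv′ A₀ ∙ A) ⁻¹ * g (inv′ A₀ ∙ B) ⁻¹)
        ≡⟨ cong (Q χ *_) (sym (trans (⁻¹-distrib-* _ _) (cong (_* g (inv′ A₀ ∙ B) ⁻¹)
             (trans (⁻¹-distrib-* _ _) (cong (_* g (inv′ A₀ ∙ A) ⁻¹) (⁻¹-distrib-* _ _)))))) ⟩
      Q χ * D ⁻¹ ∎

  hypF₊₂≡∑summand*Q/D : hypF (suc (suc k)) A₀ (As ∷ʳ A ∷ʳ B) (Bs ∷ʳ (A₀ ∙ inv′ A) ∷ʳ (A₀ ∙ inv′ B)) x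
                        ≡ q-1 ⁻¹ * ∑ chars (λ χ → summand χ * (Q χ * D ⁻¹))
  hypF₊₂≡∑summand*Q/D = cong (q-1 ⁻¹ *_) (∑-cong-∈ chars (λ χ χ∈ → summand₊₂≡summand*Q/D (members χ∈)))

  weight : Fn → Carrier
  weight ψ = g (A ∙ ψ) * g (B ∙ ψ) * g (inv′ ψ) * g (inv′ A₀ ∙ inv′ ψ)

  T′ : Fn → Carrier
  T′ χ = ∑ chars (λ ψ → g (A ∙ ψ) * g (B ∙ ψ) * g (inv′ ψ ∙ χ) * g (inv′ A₀ ∙ inv′ ψ ∙ inv′ χ))

  -- The χ-summand of hypF (suc k) A₀ (As ∷ʳ ψ̄) (Bs ∷ʳ A₀ ψ) (- x).
  summand₊₁ : Fn → Fn → Carrier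
  summand₊₁ ψ χ = g (A₀ ∙ χ) / g A₀ * (prodV F K (As ∷ʳ inv′ ψ) (upper χ) * (prodV F K (Bs ∷ʳ (A₀ ∙ ψ)) (lower χ)
                    * (g (inv′ χ) * (χ -1ᶠ ^ suc (suc k) * χ (-ᶠ x)))))

  weight*summand₊₁≡ : ∀ {ψ χ} → IsMultChar F K ψ → IsMultChar F K χ →
    weight ψ * summand₊₁ ψ χ ≡ summand χ * (g (A ∙ ψ) * g (B ∙ ψ) * g (inv′ ψ ∙ χ) * g (inv′ A₀ ∙ inv′ ψ ∙ inv′ χ))
  weight*summand₊₁≡ {ψ} {χ} ψ-char χ-char = begin
    weight ψ * (base * (prodV F K (As ∷ʳ inv′ ψ) (upper χ) * (prodV F K (Bs ∷ʳ (A₀ ∙ ψ)) (lower χ) * (gi * (s * S * χ (-ᶠ x))))))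
      ≡⟨ cong₂ (λ u v → weight ψ * (base * (u * (v * (gi * (s * S * χ (-ᶠ x)))))))
           (prodV-∷ʳ As (inv′ ψ) (upper χ)) (prodV-∷ʳ Bs (A₀ ∙ ψ) (lower χ)) ⟩
    weight ψ * (base * (pa * upper χ (inv′ ψ) * (pb * lower χ (A₀ ∙ ψ) * (gi * (s * S * χ (-ᶠ x))))))
      ≡⟨ cong (λ w → weight ψ * (base * (pa * upper χ (inv′ ψ) * (pb * lower χ (A₀ ∙ ψ) * (gi * (s * S * w)))))) (χ-neg χ-char x) ⟩
    gAψ * gBψ * gψ̄ * gĀ₀ψ̄ * (base * (pa * (gψ̄χ * gψ̄ ⁻¹) * (pb * (g₃ * g₂ ⁻¹) * (gi * (s * S * (s * xc))))))
      ≡⟨ solve 15 (λ a bb c d ba pa e f pb h i gi s S xc →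
           ((a :* bb :* c :* d) :* (ba :* (pa :* (e :* f) :* (pb :* (h :* i) :* (gi :* (s :* S :* (s :* xc)))))))
           := ((ba :* (pa :* (pb :* (gi :* (S :* xc))))) :* (a :* bb :* e :* h) :* (c :* f) :* (d :* i) :* (s :* s))) refl
           gAψ gBψ gψ̄ gĀ₀ψ̄ base pa gψ̄χ (gψ̄ ⁻¹) pb g₃ (g₂ ⁻¹) gi s S xc ⟩
    summand χ * (gAψ * gBψ * gψ̄χ * g₃) * (gψ̄ * gψ̄ ⁻¹) * (gĀ₀ψ̄ * g₂ ⁻¹) * (s * s)
      ≡⟨ cong₂ (λ u v → summand χ * (gAψ * gBψ * gψ̄χ * v) * (gψ̄ * gψ̄ ⁻¹) * (gĀ₀ψ̄ * u ⁻¹) * (s * s)) (g-cong inv[A₀ψ]) (g-cong inv[A₀ψχ]) ⟩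
    summand χ * (gAψ * gBψ * gψ̄χ * gĀ₀ψ̄χ̄) * (gψ̄ * gψ̄ ⁻¹) * (gĀ₀ψ̄ * gĀ₀ψ̄ ⁻¹) * (s * s)
      ≡⟨ cong₂ (λ u v → summand χ * (gAψ * gBψ * gψ̄χ * gĀ₀ψ̄χ̄) * u * v * (s * s))
           (inverseʳ _ (g≢0 (inv-char ψ-char))) (inverseʳ _ (g≢0 (∙-char (inv-char A₀-char) (inv-char ψ-char)))) ⟩
    summand χ * (gAψ * gBψ * gψ̄χ * gĀ₀ψ̄χ̄) * 1# * 1# * (s * s)
      ≡⟨ cong (λ w → summand χ * (gAψ * gBψ * gψ̄χ * gĀ₀ψ̄χ̄) * 1# * 1# * w) (χ[-1]²≡1 χ-char) ⟩
    summand χ * (gAψ * gBψ * gψ̄χ * gĀ₀ψ̄χ̄) * 1# * 1# * 1#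
      ≡⟨ trans (*-identityʳ _) (trans (*-identityʳ _) (*-identityʳ _)) ⟩
    summand χ * (gAψ * gBψ * gψ̄χ * gĀ₀ψ̄χ̄) ∎
    where
    base = g (A₀ ∙ χ) / g A₀
    pa = prodV F K As (upper χ)
    pb = prodV F K Bs (lower χ)
    gi = g (inv′ χ)
    s = χ -1ᶠ
    S = s ^ suc k
    xc = χ x
    gAψ = g (A ∙ ψ)
    gBψ = g (B ∙ ψ)
    gψ̄ = g (inv′ ψ)
    gĀ₀ψ̄ = g (inv′ A₀ ∙ inv′ ψ)
    gψ̄χ = g (inv′ ψ ∙ χ)
    gĀ₀ψ̄χ̄ = g (inv′ A₀ ∙ inv′ ψ ∙ inv′ χ)
    g₃ = g (inv′ (A₀ ∙ ψ ∙ χ))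
    g₂ = g (inv′ (A₀ ∙ ψ))
    inv[A₀ψ] : inv′ (A₀ ∙ ψ) ≈ inv′ A₀ ∙ inv′ ψ
    inv[A₀ψ] y = ⁻¹-distrib-* _ _
    inv[A₀ψχ] : inv′ (A₀ ∙ ψ ∙ χ) ≈ inv′ A₀ ∙ inv′ ψ ∙ inv′ χ
    inv[A₀ψχ] y = trans (⁻¹-distrib-* _ _) (cong (_* χ y ⁻¹) (⁻¹-distrib-* _ _))

  ∑weight*hypF₊₁≡ : ∑ chars (λ ψ → weight ψ * hypF (suc k) A₀ (As ∷ʳ inv′ ψ) (Bs ∷ʳ (A₀ ∙ ψ)) (-ᶠ x))
                    ≡ ∑ chars (λ χ → summand χ * (q-1 ⁻¹ * T′ χ))
  ∑weight*hypF₊₁≡ = begin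
    ∑ chars (λ ψ → weight ψ * (q-1 ⁻¹ * ∑ chars (summand₊₁ ψ)))
      ≡⟨ ∑-cong-∈ chars (λ ψ ψ∈ → trans (solve 3 (λ w n t → (w :* (n :* t)) := (n :* (w :* t))) refl (weight ψ) (q-1 ⁻¹) _)
            (cong (q-1 ⁻¹ *_) (trans (*-distribˡ-∑ chars (weight ψ) _)
              (∑-cong-∈ chars (λ χ χ∈ → weight*summand₊₁≡ (members ψ∈) (members χ∈)))))) ⟩
    ∑ chars (λ ψ → q-1 ⁻¹ * ∑ chars (λ χ → summand χ * (g (A ∙ ψ) * g (B ∙ ψ) * g (inv′ ψ ∙ χ) * g (inv′ A₀ ∙ inv′ ψ ∙ inv′ χ))))
      ≡⟨ trans (sym (*-distribˡ-∑ chars (q-1 ⁻¹) _)) (cong (q-1 ⁻¹ *_) (∑-comm chars chars _)) ⟩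
    q-1 ⁻¹ * ∑ chars (λ χ → ∑ chars (λ ψ → summand χ * (g (A ∙ ψ) * g (B ∙ ψ) * g (inv′ ψ ∙ χ) * g (inv′ A₀ ∙ inv′ ψ ∙ inv′ χ))))
      ≡⟨ trans (*-distribˡ-∑ chars (q-1 ⁻¹) _) (∑-cong chars (λ χ → trans (cong (q-1 ⁻¹ *_) (sym (*-distribˡ-∑ chars (summand χ) _)))
            (solve 3 (λ n c t → (n :* (c :* t)) := (c :* (n :* t))) refl (q-1 ⁻¹) (summand χ) (T′ χ)))) ⟩
    ∑ chars (λ χ → summand χ * (q-1 ⁻¹ * T′ χ)) ∎

  G Δ : Carrier
  G = g (inv′ A₀ ∙ A ∙ B)
  Δ = fromℕ q * q-1 * (B ∙ A) -1ᶠ * δ F K (inv′ A₀ ∙ A ∙ B)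

  reduction : hypF (suc (suc k)) A₀ (As ∷ʳ A ∷ʳ B) (Bs ∷ʳ (A₀ ∙ inv′ A) ∷ʳ (A₀ ∙ inv′ B)) x
              ≡ (G / D) * (q-1 ⁻¹ * ∑ chars (λ ψ → weight ψ * hypF (suc k) A₀ (As ∷ʳ inv′ ψ) (Bs ∷ʳ (A₀ ∙ ψ)) (-ᶠ x)))
                + (Δ / D) * hypF k A₀ As Bs x
  reduction = begin
    _ ≡⟨ hypF₊₂≡∑summand*Q/D ⟩
    q-1 ⁻¹ * ∑ chars (λ χ → summand χ * (Q χ * D ⁻¹))
      ≡⟨ cong (q-1 ⁻¹ *_) (∑-cong-∈ chars (λ χ χ∈ →
           trans (cong (λ w → summand χ * (w * D ⁻¹)) (XPRZ≡G[T/[q-1]]+[…]δμ A₀-char A-char B-char (members χ∈)))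
            (solve 5 (λ c gg t qq di → (c :* ((gg :* t :+ qq) :* di)) := (gg :* di :* (c :* t) :+ qq :* di :* c)) refl
               (summand χ) G (q-1 ⁻¹ * T′ χ) Δ (D ⁻¹)))) ⟩
    q-1 ⁻¹ * ∑ chars (λ χ → G * D ⁻¹ * (summand χ * (q-1 ⁻¹ * T′ χ)) + Δ * D ⁻¹ * summand χ)
      ≡⟨ cong (q-1 ⁻¹ *_) (trans (∑-distrib-+ chars _ _) (sym (cong₂ _+_ (*-distribˡ-∑ chars _ _) (*-distribˡ-∑ chars _ _)))) ⟩
    q-1 ⁻¹ * (G * D ⁻¹ * ∑ chars (λ χ → summand χ * (q-1 ⁻¹ * T′ χ)) + Δ * D ⁻¹ * ∑ chars summand)
      ≡⟨ solve 5 (λ n gd s₁ qd s₂ → (n :* (gd :* s₁ :+ qd :* s₂)) := (gd :* (n :* s₁) :+ qd :* (n :* s₂))) refl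
           (q-1 ⁻¹) (G * D ⁻¹) (∑ chars (λ χ → summand χ * (q-1 ⁻¹ * T′ χ))) (Δ * D ⁻¹) (∑ chars summand) ⟩
    (G / D) * (q-1 ⁻¹ * ∑ chars (λ χ → summand χ * (q-1 ⁻¹ * T′ χ))) + (Δ / D) * (q-1 ⁻¹ * ∑ chars summand)
      ≡⟨ cong (λ w → (G / D) * (q-1 ⁻¹ * w) + (Δ / D) * (q-1 ⁻¹ * ∑ chars summand)) (sym ∑weight*hypF₊₁≡) ⟩
    _ ∎

-- IsNontrivAddChar does not force θ 0 = 1: since θ 0 = θ 0 * θ 0 the alternative is θ ≡ 0,
-- where every Gauss sum, and hence both sides of the theorem, vanish.
module DegenerateAdditiveCharacter (F : FiniteField) (K : CharZeroField) (θ : Fun F K) (θ-char : IsNontrivAddChar F K θ)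
                                   (θ0≢1 : θ (FiniteField.0# F) ≢ CharZeroField.1# K) (chars : List (Fun F K)) where
  open Characters F K
  open IsNontrivAddChar θ-char
  open WithData F K θ chars using (g; hypF)

  θ≡0 : ∀ y → θ y ≡ 0#
  θ≡0 y = trans (cong θ (sym (𝔽.+-identityʳ y))) (trans (add y 0ᶠ) (trans (cong (θ y *_) θ0≡0) (zeroʳ _)))
    where
    θ0≡0 : θ 0ᶠ ≡ 0#
    θ0≡0 = c*x≡x⇒x≡0 (θ 0ᶠ) (θ 0ᶠ) θ0≢1 (sym (trans (cong θ (sym (𝔽.+-identityʳ 0ᶠ))) (add 0ᶠ 0ᶠ)))

  g≡0 : ∀ χ → g χ ≡ 0#
  g≡0 χ = ∑-zero elems (λ y → trans (cong (χ y *_) (θ≡0 y)) (zeroʳ _))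

  hypF≡0 : ∀ m A₀ (As Bs : Vec Fn m) y → hypF m A₀ As Bs y ≡ 0#
  hypF≡0 m A₀ As Bs y = trans (cong ((fromℕ (q ∸ 1)) ⁻¹ *_) (∑-zero chars (λ χ → x≡0⇒x*y*z≡0 (g≡0 (A₀ ∙ χ))))) (zeroʳ _)
    where
    x≡0⇒x*y*z≡0 : ∀ {x y z} → x ≡ 0# → x * y * z ≡ 0#
    x≡0⇒x*y*z≡0 refl = trans (cong (_* _) (zeroˡ _)) (zeroˡ _)

  a/d*s+b/d*t≡0 : ∀ {a b s t d} → d ≡ 0# → (a / d) * s + (b / d) * t ≡ 0#
  a/d*s+b/d*t≡0 refl = trans (cong₂ _+_ a/0*c≡0 a/0*c≡0) (+-identityˡ 0#)
    where
    a/0*c≡0 : ∀ {a c} → (a / 0#) * c ≡ 0#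
    a/0*c≡0 {a} {c} = trans (cong (λ z → a * z * c) 0⁻¹≡0) (trans (cong (_* c) (zeroʳ a)) (zeroˡ c))

theorem1p7 : (F : FiniteField) (K : CharZeroField)
    (θ : Fun F K) → IsNontrivAddChar F K θ →
    (chars : List (Fun F K)) → IsCharGroup F K chars →
    (k : ℕ) (A₀ : Fun F K) (As : Vec (Fun F K) k) (Aₙ₋₁ Aₙ : Fun F K) →
    IsMultChar F K A₀ → All (IsMultChar F K) As →
    IsMultChar F K Aₙ₋₁ → IsMultChar F K Aₙ →
    (x : FiniteField.Carrier F) →
    let open CharZeroField K
        open WithData F K θ chars
        _∙_ = _·_ F K
        inv′ = inv F K
        D = g Aₙ₋₁ * g Aₙ * g (inv′ A₀ ∙ Aₙ₋₁) * g (inv′ A₀ ∙ Aₙ)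
        Bs = map (λ A → A₀ ∙ inv′ A) As
    in hypF (suc (suc k)) A₀ (As ∷ʳ Aₙ₋₁ ∷ʳ Aₙ) (Bs ∷ʳ (A₀ ∙ inv′ Aₙ₋₁) ∷ʳ (A₀ ∙ inv′ Aₙ)) x
       ≡ (g ((inv′ A₀ ∙ Aₙ₋₁) ∙ Aₙ) / D)
           * ((fromℕ (FiniteField.q F ∸ 1)) ⁻¹
              * sumL F K chars (λ ψ →
                  g (Aₙ₋₁ ∙ ψ) * g (Aₙ ∙ ψ) * g (inv′ ψ) * g (inv′ A₀ ∙ inv′ ψ)
                  * hypF (suc k) A₀ (As ∷ʳ inv′ ψ) (Bs ∷ʳ (A₀ ∙ ψ))
                         (FiniteField.-_ F x)))
         + (fromℕ (FiniteField.q F) * fromℕ (FiniteField.q F ∸ 1)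
              * (Aₙ ∙ Aₙ₋₁) (FiniteField.-_ F (FiniteField.1# F))
              * δ F K ((inv′ A₀ ∙ Aₙ₋₁) ∙ Aₙ) / D)
           * hypF k A₀ As Bs x
theorem1p7 F K θ θ-char chars cg k A₀ As A B A₀-char _ A-char B-char x
  with CharZeroField._≟_ K (θ (FiniteField.0# F)) (CharZeroField.1# K)
... | yes θ0≡1 = Reduction.reduction F K θ θ-char θ0≡1 chars cg k A₀ As A B A₀-char A-char B-char x
... | no θ0≢1  = trans (hypF≡0 (suc (suc k)) A₀ (As ∷ʳ A ∷ʳ B) (map (λ A′ → A₀ ∙ inv′ A′) As ∷ʳ (A₀ ∙ inv′ A) ∷ʳ (A₀ ∙ inv′ B)) x) (sym (a/d*s+b/d*t≡0 D≡0))
  where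
  open DegenerateAdditiveCharacter F K θ θ-char θ0≢1 chars
  open Characters F K using (_∙_; inv′; _*_; 0#; zeroˡ)
  open WithData F K θ chars using (g)
  D≡0 : g A * g B * g (inv′ A₀ ∙ A) * g (inv′ A₀ ∙ B) ≡ 0#
  D≡0 = trans (cong (λ z → z * g B * g (inv′ A₀ ∙ A) * g (inv′ A₀ ∙ B)) (g≡0 A))
          (trans (cong (λ z → z * g (inv′ A₀ ∙ A) * g (inv′ A₀ ∙ B)) (zeroˡ _)) (trans (cong (_* g (inv′ A₀ ∙ B)) (zeroˡ _)) (zeroˡ _)))
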